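{- Let $p$ be an odd prime and $r\ge1$ an integer. The linear complexity over $\mathbb{F}_p$ of the sequence $(H_{r-1}(u))_{u\ge0}$ (viewed as a sequence over $\mathbb{F}_p$) equals $p^{r}+p-1$.
   Context: Let $\varphi$ be Euler's totient function. For an integer $r\ge1$, the Euler quotient $Q_r(u)$ is the unique integer with $0\le Q_r(u)<p^r$ and $Q_r(u)\equiv \frac{u^{\varphi(p^r)}-1}{p^r}\pmod{p^r}$ when $\gcd(u,p)=1$; and $Q_r(u)=0$ when $p\mid u$. One has $Q_r(u)\equiv Q_{r-1}(u)\pmod{p^{r-1}}$ for $r\ge2$. Define $H_0(u)=Q_1(u)$ and, for $r\ge2$, $H_{r-1}(u)$ as the unique integer with $0\le H_{r-1}(u)<p$ and $H_{r-1}(u)\equiv \frac{Q_r(u)-Q_{r-1}(u)}{p^{r-1}}\pmod p$ (the highest $p$-adic digit of $Q_r(u)$). The linear complexity over a field $\mathbb{F}$ of a periodic sequence $(s(u))_{u\ge0}$ is the least $L$ such that there are $c_0\ne0,c_1,\dots,c_{L-1}\in\mathbb{F}$ with $s(u+L)=c_{L-1}s(u+L-1)+\dots+c_0s(u)$ for all $u\ge0$. -}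

module Defs where

open import Data.Nat using (ℕ; zero; suc; _+_; _*_; _∸_; _^_; _<_; NonZero)
open import Data.Nat.Properties using (m^n≢0; _≟_)
open import Data.Nat.DivMod using (_/_; _%_)
open import Data.Nat.GCD using (gcd)
open import Data.List using (List; filter; length; upTo; map)
open import Data.Fin using (Fin; toℕ) renaming (zero to fzero)
open import Data.Product using (Σ; _×_)
open import Relation.Binary.PropositionalEquality using (_≡_)
open import Relation.Nullary using (¬_)

φ : ℕ → ℕ
φ n = length (filter (λ k → gcd k n ≟ 1) (map suc (upTo n)))

Q : (p : ℕ) → .{{NonZero p}} → (r u : ℕ) → ℕ
Q p r u with gcd u p ≟ 1
... | Relation.Nullary.yes _ = ((u ^ φ (p ^ r) ∸ 1) / (p ^ r)) % (p ^ r)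
  where instance _ = m^n≢0 p r
... | Relation.Nullary.no _ = 0

H : (p : ℕ) → .{{NonZero p}} → (k u : ℕ) → ℕ
H p zero u = Q p 1 u
H p (suc k) u = ((Q p (suc (suc k)) u ∸ Q p (suc k) u) / (p ^ suc k)) % p
  where instance _ = m^n≢0 p (suc k)

sumFin : (n : ℕ) → (Fin n → ℕ) → ℕ
sumFin zero f = 0
sumFin (suc n) f = f fzero + sumFin n (λ i → f (Data.Fin.suc i))

-- Elements of F_p are represented by natural numbers, equality in F_p is
-- equality of residues mod p.
_≡[_]_ : ℕ → (p : ℕ) → .{{NonZero p}} → ℕ → Set
a ≡[ p ] b = a % p ≡ b % p

-- For L = 0 there is no c_0, so the condition c_0 ≠ 0 cannot hold.
HasRecurrence : (p : ℕ) → .{{NonZero p}} → (ℕ → ℕ) → ℕ → Set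
HasRecurrence p s zero = Data.Empty.⊥
  where import Data.Empty
HasRecurrence p s (suc k) =
  Σ (Fin (suc k) → ℕ) λ c →
    (¬ (c fzero ≡[ p ] 0)) ×
    ((u : ℕ) → s (u + suc k) ≡[ p ] sumFin (suc k) (λ i → c i * s (u + toℕ i)))

LinearComplexity : (p : ℕ) → .{{NonZero p}} → (ℕ → ℕ) → ℕ → Set
LinearComplexity p s L =
  HasRecurrence p s L × ((L′ : ℕ) → L′ < L → ¬ HasRecurrence p s L′)

module Submission where

-- Write s u = H_k(u), R = p ^ (k + 1), L = R + p − 1 and Δ for the forward difference.
-- Lifting Euler's theorem from pʳ to pʳ⁺¹ shows that shifting u by R changes the digit
-- H_k(u) by −u ^ (p − 2) modulo p. Modulo p the operator Δ ^ R is the R-step difference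
-- (Frobenius), so Δ ^ R s ≡ −u ^ (p − 2), a polynomial of degree p − 2. Hence Δ ^ L s ≡ 0,
-- a recurrence of length L with characteristic polynomial (x − 1) ^ L, while
-- Δ ^ (L − 1) s 0 ≡ −(p − 2)! ≢ 0. Conversely, if some power of Δ annihilates a sequence
-- satisfying a recurrence of length l, then already Δ ^ l does; so none is shorter than L.

open import Data.Nat.Base using (ℕ; suc)
open import Data.Nat.Divisibility using (_∣_)
open import Data.Nat.Primality using (Prime)
open import Relation.Nullary.Negation using (¬_)
open import Defs

module Sums where

  open import Data.Nat.Base as ℕ using (ℕ; zero; suc; s≤s)
  open import Data.Nat.Properties using (m<n⇒m<1+n; n<1+n)
  open import Data.Integer.Base using (ℤ; +_; _+_; _*_; _-_; -_; 0ℤ; -1ℤ)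
  open import Data.Fin.Base using (Fin; toℕ) renaming (zero to fzero; suc to fsuc)
  open import Data.Integer.Properties
    using (+-identityˡ; +-identityʳ; +-assoc; *-zeroʳ; *-distribˡ-+; *-comm; -1*i≡-i; pos-+; pos-*)
  open import Data.Integer.Tactic.RingSolver using (solve-∀)
  open import Function.Base using (_∘_)
  open import Relation.Binary.PropositionalEquality

  Σ< : ℕ → (ℕ → ℤ) → ℤ
  Σ< zero    f = 0ℤ
  Σ< (suc n) f = Σ< n f + f n

  Σ<-cong : ∀ n {f g : ℕ → ℤ} → (∀ i → i ℕ.< n → f i ≡ g i) → Σ< n f ≡ Σ< n g
  Σ<-cong zero    f≡g = refl
  Σ<-cong (suc n) f≡g =
    cong₂ _+_ (Σ<-cong n (λ i i<n → f≡g i (m<n⇒m<1+n i<n))) (f≡g n (n<1+n n))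

  Σ<-suc : ∀ n (f : ℕ → ℤ) → Σ< (suc n) f ≡ f 0 + Σ< n (f ∘ suc)
  Σ<-suc zero    f = trans (+-identityˡ (f 0)) (sym (+-identityʳ (f 0)))
  Σ<-suc (suc n) f = begin
    Σ< (suc n) f + f (suc n)               ≡⟨ cong (_+ f (suc n)) (Σ<-suc n f) ⟩
    f 0 + Σ< n (f ∘ suc) + f (suc n)       ≡⟨ +-assoc (f 0) _ _ ⟩
    f 0 + (Σ< n (f ∘ suc) + f (suc n))     ∎
    where open ≡-Reasoning

  Σ<-+ : ∀ n (f g : ℕ → ℤ) → Σ< n (λ i → f i + g i) ≡ Σ< n f + Σ< n g
  Σ<-+ zero    f g = refl
  Σ<-+ (suc n) f g =
    trans (cong (_+ (f n + g n)) (Σ<-+ n f g)) (interchange (Σ< n f) (Σ< n g) (f n) (g n))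
    where
    interchange : ∀ a b c d → a + b + (c + d) ≡ a + c + (b + d)
    interchange = solve-∀

  Σ<-*ˡ : ∀ n c (f : ℕ → ℤ) → Σ< n (λ i → c * f i) ≡ c * Σ< n f
  Σ<-*ˡ zero    c f = sym (*-zeroʳ c)
  Σ<-*ˡ (suc n) c f =
    trans (cong (_+ c * f n) (Σ<-*ˡ n c f)) (sym (*-distribˡ-+ c (Σ< n f) (f n)))

  Σ<-*ʳ : ∀ n (f : ℕ → ℤ) c → Σ< n (λ i → f i * c) ≡ Σ< n f * c
  Σ<-*ʳ n f c = begin
    Σ< n (λ i → f i * c)  ≡⟨ Σ<-cong n (λ i _ → *-comm (f i) c) ⟩
    Σ< n (λ i → c * f i)  ≡⟨ Σ<-*ˡ n c f ⟩
    c * Σ< n f            ≡⟨ *-comm c _ ⟩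
    Σ< n f * c            ∎
    where open ≡-Reasoning

  Σ<-neg : ∀ n (f : ℕ → ℤ) → Σ< n (λ i → - f i) ≡ - Σ< n f
  Σ<-neg n f = begin
    Σ< n (λ i → - f i)      ≡⟨ Σ<-cong n (λ i _ → sym (-1*i≡-i (f i))) ⟩
    Σ< n (λ i → -1ℤ * f i)  ≡⟨ Σ<-*ˡ n -1ℤ f ⟩
    -1ℤ * Σ< n f            ≡⟨ -1*i≡-i _ ⟩
    - Σ< n f                ∎
    where open ≡-Reasoning

  Σ<-minus : ∀ n (f g : ℕ → ℤ) → Σ< n (λ i → f i - g i) ≡ Σ< n f - Σ< n g
  Σ<-minus n f g = trans (Σ<-+ n f (λ i → - g i)) (cong (_+_ (Σ< n f)) (Σ<-neg n g))

  Σ<-summation-by-parts : ∀ l (c W : ℕ → ℤ) →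
    Σ< l (λ i → Σ< (suc i) c * (W (suc i) - W i)) ≡ Σ< l c * W l - Σ< l (λ i → c i * W i)
  Σ<-summation-by-parts zero    c W = sym (*-zeroˡ-minus (W 0))
    where
    *-zeroˡ-minus : ∀ x → 0ℤ * x - 0ℤ ≡ 0ℤ
    *-zeroˡ-minus = solve-∀
  Σ<-summation-by-parts (suc l) c W =
    trans (cong (_+ (Σ< l c + c l) * (W (suc l) - W l)) (Σ<-summation-by-parts l c W))
          (step (Σ< l c) (Σ< l (λ i → c i * W i)) (c l) (W l) (W (suc l)))
    where
    step : ∀ C S cₗ wₗ wₗ₊₁ →
           C * wₗ - S + (C + cₗ) * (wₗ₊₁ - wₗ) ≡ (C + cₗ) * wₗ₊₁ - (S + cₗ * wₗ)
    step = solve-∀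

  extendByZero : ∀ {n} → (Fin n → ℕ) → ℕ → ℕ
  extendByZero {zero}  c _       = 0
  extendByZero {suc n} c zero    = c fzero
  extendByZero {suc n} c (suc j) = extendByZero (c ∘ fsuc) j

  extendByZero-toℕ : ∀ n (f : ℕ → ℕ) j → j ℕ.< n → extendByZero {n} (f ∘ toℕ) j ≡ f j
  extendByZero-toℕ (suc n) f zero    _         = refl
  extendByZero-toℕ (suc n) f (suc j) (s≤s j<n) = extendByZero-toℕ n (f ∘ suc) j j<n

  +sumFin≡Σ< : ∀ n (c : Fin n → ℕ) (h : ℕ → ℕ) →
               + sumFin n (λ i → c i ℕ.* h (toℕ i)) ≡ Σ< n (λ j → + extendByZero c j * + h j)
  +sumFin≡Σ< zero    c h = refl
  +sumFin≡Σ< (suc n) c h = begin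
    + (c fzero ℕ.* h 0 ℕ.+ sumFin n (λ i → c (fsuc i) ℕ.* h (suc (toℕ i))))
      ≡⟨ pos-+ (c fzero ℕ.* h 0) _ ⟩
    + (c fzero ℕ.* h 0) + + sumFin n (λ i → c (fsuc i) ℕ.* h (suc (toℕ i)))
      ≡⟨ cong₂ _+_ (pos-* (c fzero) (h 0)) (+sumFin≡Σ< n (c ∘ fsuc) (h ∘ suc)) ⟩
    + c fzero * + h 0 + Σ< n (λ j → + extendByZero (c ∘ fsuc) j * + h (suc j))
      ≡⟨ sym (Σ<-suc n (λ j → + extendByZero c j * + h j)) ⟩
    Σ< (suc n) (λ j → + extendByZero c j * + h j)
      ∎
    where open ≡-Reasoning

module Congruence (n : ℕ) where

  open import Data.Nat.Base as ℕ using (NonZero)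
  open import Data.Nat.Properties using (m<n⇒m<1+n; n<1+n)
  open import Data.Nat.DivMod as ℕ using ([m+kn]%n≡m%n)
  open import Data.Integer.Base using (ℤ; +_; -[1+_]; _+_; _*_; _-_; -_; 0ℤ)
  open import Data.Integer.DivMod using (_%ℕ_; _/ℕ_; a≡a%ℕn+[a/ℕn]*n)
  open import Data.Integer.Divisibility.Signed
    using (divides; ∣m∣n⇒∣m+n; ∣m⇒∣-m; ∣n⇒∣m*n) renaming (_∣_ to _∣ℤ_)
  open import Data.Integer.Properties using (+-inverseʳ; pos-+; pos-*; +-injective; neg-distribˡ-*; *-comm)
  open import Data.Integer.Tactic.RingSolver using (solve-∀)
  open import Relation.Binary.Bundles using (Setoid)
  open import Relation.Binary.Structures using (IsEquivalence)
  import Relation.Binary.Reasoning.Setoid as SetoidReasoning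
  open import Relation.Binary.PropositionalEquality

  open Sums

  infix 4 _≈_
  record _≈_ (x y : ℤ) : Set where
    constructor mk≈
    field divides-difference : + n ∣ℤ x - y
  open _≈_ public

  ≈-by : ∀ {x y} k → x ≡ y + k * + n → x ≈ y
  ≈-by {x} {y} k refl = mk≈ (divides k (difference y (k * + n)))
    where
    difference : ∀ a b → a + b - a ≡ b
    difference = solve-∀

  ≈-refl : ∀ {x} → x ≈ x
  ≈-refl {x} = mk≈ (divides 0ℤ (+-inverseʳ x))

  ≈-reflexive : ∀ {x y} → x ≡ y → x ≈ y
  ≈-reflexive refl = ≈-refl

  ≈-sym : ∀ {x y} → x ≈ y → y ≈ x
  ≈-sym {x} {y} (mk≈ n∣x-y) = mk≈ (subst (+ n ∣ℤ_) (flip x y) (∣m⇒∣-m n∣x-y))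
    where
    flip : ∀ a b → - (a - b) ≡ b - a
    flip = solve-∀

  ≈-trans : ∀ {x y z} → x ≈ y → y ≈ z → x ≈ z
  ≈-trans {x} {y} {z} (mk≈ n∣x-y) (mk≈ n∣y-z) =
    mk≈ (subst (+ n ∣ℤ_) (chain x y z) (∣m∣n⇒∣m+n n∣x-y n∣y-z))
    where
    chain : ∀ a b c → (a - b) + (b - c) ≡ a - c
    chain = solve-∀

  ≈-isEquivalence : IsEquivalence _≈_
  ≈-isEquivalence = record { refl = ≈-refl ; sym = ≈-sym ; trans = ≈-trans }

  ≈-setoid : Setoid _ _
  ≈-setoid = record { isEquivalence = ≈-isEquivalence }

  +-cong : ∀ {x x′ y y′} → x ≈ x′ → y ≈ y′ → x + y ≈ x′ + y′
  +-cong {x} {x′} {y} {y′} (mk≈ n∣x-x′) (mk≈ n∣y-y′) =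
    mk≈ (subst (+ n ∣ℤ_) (regroup x x′ y y′) (∣m∣n⇒∣m+n n∣x-x′ n∣y-y′))
    where
    regroup : ∀ a a′ b b′ → (a - a′) + (b - b′) ≡ a + b - (a′ + b′)
    regroup = solve-∀

  -‿cong : ∀ {x y} → x ≈ y → - x ≈ - y
  -‿cong {x} {y} (mk≈ n∣x-y) = mk≈ (subst (+ n ∣ℤ_) (regroup x y) (∣m⇒∣-m n∣x-y))
    where
    regroup : ∀ a b → - (a - b) ≡ - a - - b
    regroup = solve-∀

  -‿cong₂ : ∀ {x x′ y y′} → x ≈ x′ → y ≈ y′ → x - y ≈ x′ - y′
  -‿cong₂ x≈x′ y≈y′ = +-cong x≈x′ (-‿cong y≈y′)

  *-congˡ : ∀ c {x y} → x ≈ y → c * x ≈ c * y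
  *-congˡ c {x} {y} (mk≈ n∣x-y) = mk≈ (subst (+ n ∣ℤ_) (regroup c x y) (∣n⇒∣m*n c n∣x-y))
    where
    regroup : ∀ k a b → k * (a - b) ≡ k * a - k * b
    regroup = solve-∀

  *-congʳ : ∀ c {x y} → x ≈ y → x * c ≈ y * c
  *-congʳ c {x} {y} x≈y = subst₂ _≈_ (*-comm c x) (*-comm c y) (*-congˡ c x≈y)

  ∣⇒≈0 : ∀ {x} → + n ∣ℤ x → x ≈ 0ℤ
  ∣⇒≈0 {x} n∣x = mk≈ (subst (+ n ∣ℤ_) (minus-zero x) n∣x)
    where
    minus-zero : ∀ a → a ≡ a - 0ℤ
    minus-zero = solve-∀

  ≈0⇒∣ : ∀ {x} → x ≈ 0ℤ → + n ∣ℤ x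
  ≈0⇒∣ {x} (mk≈ n∣x-0) = subst (+ n ∣ℤ_) (minus-zero x) n∣x-0
    where
    minus-zero : ∀ a → a - 0ℤ ≡ a
    minus-zero = solve-∀

  Σ<-cong-≈ : ∀ l {f g : ℕ → ℤ} → (∀ i → i ℕ.< l → f i ≈ g i) → Σ< l f ≈ Σ< l g
  Σ<-cong-≈ ℕ.zero    f≈g = ≈-refl
  Σ<-cong-≈ (ℕ.suc l) f≈g =
    +-cong (Σ<-cong-≈ l (λ i i<l → f≈g i (m<n⇒m<1+n i<l))) (f≈g l (n<1+n l))

  Σ<-≈0 : ∀ l {f : ℕ → ℤ} → (∀ i → i ℕ.< l → + n ∣ℤ f i) → Σ< l f ≈ 0ℤ
  Σ<-≈0 ℕ.zero    n∣f = ≈-refl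
  Σ<-≈0 (ℕ.suc l) n∣f =
    +-cong (Σ<-≈0 l (λ i i<l → n∣f i (m<n⇒m<1+n i<l))) (∣⇒≈0 (n∣f l (n<1+n l)))

  module ≈-Reasoning = SetoidReasoning ≈-setoid

  infix 4 _≈ₛ_
  _≈ₛ_ : (ℕ → ℤ) → (ℕ → ℤ) → Set
  v ≈ₛ w = ∀ u → v u ≈ w u

  module _ .{{_ : NonZero n}} where

    +[%ℕ]≈ : ∀ z → + (z %ℕ n) ≈ z
    +[%ℕ]≈ z = ≈-sym (≈-by (z /ℕ n) (a≡a%ℕn+[a/ℕn]*n z n))

    %≡%⇒≈ : ∀ a b → a ℕ.% n ≡ b ℕ.% n → + a ≈ + b
    %≡%⇒≈ a b a%n≡b%n =
      ≈-trans (≈-sym (+[%ℕ]≈ (+ a))) (≈-trans (≈-reflexive (cong +_ a%n≡b%n)) (+[%ℕ]≈ (+ b)))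

    +k*n-%≡% : ∀ a b k → + a ≡ + b + + k * + n → a ℕ.% n ≡ b ℕ.% n
    +k*n-%≡% a b k a≡b+k*n = begin
      a ℕ.% n                  ≡⟨ cong (ℕ._% n) (+-injective (trans a≡b+k*n cast)) ⟩
      (b ℕ.+ k ℕ.* n) ℕ.% n    ≡⟨ [m+kn]%n≡m%n b k n ⟩
      b ℕ.% n                  ∎
      where
      open ≡-Reasoning
      cast : + b + + k * + n ≡ + (b ℕ.+ k ℕ.* n)
      cast = sym (trans (pos-+ b (k ℕ.* n)) (cong (_+_ (+ b)) (pos-* k n)))

    ≈⇒%≡% : ∀ a b → + a ≈ + b → a ℕ.% n ≡ b ℕ.% n
    ≈⇒%≡% a b (mk≈ (divides (+ k) a-b≡k*n)) =
      +k*n-%≡% a b k (trans (cancel (+ a) (+ b)) (cong (_+_ (+ b)) a-b≡k*n))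
      where
      cancel : ∀ x y → x ≡ y + (x - y)
      cancel = solve-∀
    ≈⇒%≡% a b (mk≈ (divides -[1+ k ] a-b≡-k*n)) =
      sym (+k*n-%≡% b a (ℕ.suc k) (begin
        + b                         ≡⟨ cancel (+ a) (+ b) ⟩
        + a - (+ a - + b)           ≡⟨ cong (_-_ (+ a)) a-b≡-k*n ⟩
        + a - -[1+ k ] * + n        ≡⟨ cong (_+_ (+ a)) (neg-distribˡ-* -[1+ k ] (+ n)) ⟩
        + a + + ℕ.suc k * + n       ∎))
      where
      open ≡-Reasoning
      cancel : ∀ x y → y ≡ x - (x - y)
      cancel = solve-∀

module Differences where

  open import Data.Nat.Base as ℕ using (ℕ; zero; suc; _<_; s≤s)
  open import Data.Nat.Properties using (m<n⇒m<1+n; n<1+n; *-zeroʳ; +-identityʳ; +-assoc; *-suc)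
  open import Data.Integer.Base using (ℤ; +_; _+_; _*_; _-_; -_; 0ℤ; 1ℤ; -1ℤ; ∣_∣; _^_)
  import Data.Integer.Properties as ℤₚ
  open ℤₚ using (pos-+; *-identityˡ; neg-involutive; ∣-i∣≡∣i∣; ^-distribˡ-+-*)
  open import Data.Integer.Tactic.RingSolver using (solve-∀)
  import Function.Endo.Propositional as Endo
  import Algebra.Properties.Monoid.Mult as MonoidMult
  open import Relation.Binary.PropositionalEquality

  open Sums

  Seq : Set
  Seq = ℕ → ℤ

  open Endo Seq public using () renaming (_^_ to _∘ⁿ_; ^-homo to ∘ⁿ-homo)
  open MonoidMult (Endo.∘-id-monoid Seq) public using () renaming (×-assocˡ to ∘ⁿ-*)

  ∘ⁿ-sucʳ : ∀ (F : Seq → Seq) n w → (F ∘ⁿ suc n) w ≡ (F ∘ⁿ n) (F w)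
  ∘ⁿ-sucʳ F zero    w = refl
  ∘ⁿ-sucʳ F (suc n) w = cong F (∘ⁿ-sucʳ F n w)

  Δ[_] : ℕ → Seq → Seq
  Δ[ d ] w u = w (u ℕ.+ d) - w u

  Δ : Seq → Seq
  Δ = Δ[ 1 ]

  -- Polynomials are coefficient sequences (a i is the coefficient of xⁱ): [x-1]* a is (x − 1) a.
  [x-1]* : (ℕ → ℤ) → ℕ → ℤ
  [x-1]* a zero    = - a zero
  [x-1]* a (suc i) = a i - a (suc i)

  [x-1]^ : ℕ → ℕ → ℤ
  [x-1]^ zero    zero    = 1ℤ
  [x-1]^ zero    (suc i) = 0ℤ
  [x-1]^ (suc n)         = [x-1]* ([x-1]^ n)

  [x-1]^-vanishes : ∀ n i → n < i → [x-1]^ n i ≡ 0ℤ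
  [x-1]^-vanishes zero    (suc i) _         = refl
  [x-1]^-vanishes (suc n) (suc i) (s≤s n<i) =
    cong₂ _-_ ([x-1]^-vanishes n i n<i) ([x-1]^-vanishes n (suc i) (m<n⇒m<1+n n<i))

  [x-1]^-leading : ∀ n → [x-1]^ n n ≡ 1ℤ
  [x-1]^-leading zero    = refl
  [x-1]^-leading (suc n) = cong₂ _-_ ([x-1]^-leading n) ([x-1]^-vanishes n (suc n) (n<1+n n))

  ∣[x-1]^-constant∣ : ∀ n → ∣ [x-1]^ n 0 ∣ ≡ 1
  ∣[x-1]^-constant∣ zero    = refl
  ∣[x-1]^-constant∣ (suc n) = trans (∣-i∣≡∣i∣ ([x-1]^ n 0)) (∣[x-1]^-constant∣ n)

  [x-1]^-constant-odd : ∀ k → [x-1]^ (suc (k ℕ.* 2)) 0 ≡ -1ℤ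
  [x-1]^-constant-odd zero    = refl
  [x-1]^-constant-odd (suc k) = trans (cong -_ (neg-involutive _)) ([x-1]^-constant-odd k)

  -- The derivative of (x - 1)ⁿ⁺¹ is (n + 1)(x - 1)ⁿ.
  [x-1]^-derivative : ∀ n i → + suc i * [x-1]^ (suc n) (suc i) ≡ + suc n * [x-1]^ n i
  [x-1]^-derivative zero    zero    = refl
  [x-1]^-derivative zero    (suc i) = ℤₚ.*-zeroʳ (+ suc (suc i))
  [x-1]^-derivative (suc n) zero    = begin
    1ℤ * (A - B)                  ≡⟨ unit A B ⟩
    A - 1ℤ * B                    ≡⟨ cong (_-_ A) ([x-1]^-derivative n 0) ⟩
    - x - + suc n * x             ≡⟨ cong (λ z → - x - z * x) (pos-+ 1 n) ⟩
    - x - (1ℤ + + n) * x          ≡⟨ collect x (+ n) ⟩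
    (1ℤ + (1ℤ + + n)) * - x       ≡⟨ cong (_* A) (sym (pos-+ 1 (suc n))) ⟩
    + suc (suc n) * A             ∎
    where
    open ≡-Reasoning
    x = [x-1]^ n 0
    A = [x-1]^ (suc n) 0
    B = [x-1]^ (suc n) 1
    unit : ∀ a b → 1ℤ * (a - b) ≡ a - 1ℤ * b
    unit = solve-∀
    collect : ∀ x n → - x - (1ℤ + n) * x ≡ (1ℤ + (1ℤ + n)) * - x
    collect = solve-∀
  [x-1]^-derivative (suc n) (suc i) = begin
    + suc (suc i) * (A - B)
      ≡⟨ cong (λ z → z * (A - B)) (pos-+ 1 (suc i)) ⟩
    (1ℤ + + suc i) * (A - B)
      ≡⟨ expand (+ suc i) A B ⟩
    + suc i * A + A - (1ℤ + + suc i) * B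
      ≡⟨ cong (λ z → + suc i * A + A - z * B) (sym (pos-+ 1 (suc i))) ⟩
    + suc i * A + A - + suc (suc i) * B
      ≡⟨ cong₂ (λ s t → s + A - t) ([x-1]^-derivative n i) ([x-1]^-derivative n (suc i)) ⟩
    + suc n * x + (x - y) - + suc n * y
      ≡⟨ collect (+ suc n) x y ⟩
    (1ℤ + + suc n) * (x - y)
      ≡⟨ cong (_* A) (sym (pos-+ 1 (suc n))) ⟩
    + suc (suc n) * A
      ∎
    where
    open ≡-Reasoning
    x = [x-1]^ n i
    y = [x-1]^ n (suc i)
    A = [x-1]^ (suc n) (suc i)
    B = [x-1]^ (suc n) (suc (suc i))
    expand : ∀ k a b → (1ℤ + k) * (a - b) ≡ k * a + a - (1ℤ + k) * b
    expand = solve-∀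
    collect : ∀ k a b → k * a + (a - b) - k * b ≡ (1ℤ + k) * (a - b)
    collect = solve-∀

  Σ<-[x-1]* : ∀ n (a g : ℕ → ℤ) →
    Σ< (suc n) (λ i → [x-1]* a i * g i) ≡ Σ< n (λ i → a i * g (suc i)) - Σ< (suc n) (λ i → a i * g i)
  Σ<-[x-1]* zero    a g = regroup (a 0) (g 0)
    where
    regroup : ∀ a g → 0ℤ + - a * g ≡ 0ℤ - (0ℤ + a * g)
    regroup = solve-∀
  Σ<-[x-1]* (suc n) a g =
    trans (cong (_+ (a n - a (suc n)) * g (suc n)) (Σ<-[x-1]* n a g))
          (regroup (Σ< n (λ i → a i * g (suc i))) (Σ< (suc n) (λ i → a i * g i)) (a n) (a (suc n)) (g (suc n)))
    where
    regroup : ∀ S T aₙ aₙ₊₁ g → S - T + (aₙ - aₙ₊₁) * g ≡ S + aₙ * g - (T + aₙ₊₁ * g)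
    regroup = solve-∀

  Δ∘ⁿ-expansion : ∀ d n (w : Seq) u →
    (Δ[ d ] ∘ⁿ n) w u ≡ Σ< (suc n) (λ i → [x-1]^ n i * w (u ℕ.+ d ℕ.* i))
  Δ∘ⁿ-expansion d zero    w u = begin
    w u                                  ≡⟨ cong w (sym (trans (cong (u ℕ.+_) (*-zeroʳ d)) (+-identityʳ u))) ⟩
    w (u ℕ.+ d ℕ.* 0)                    ≡⟨ sym (ℤₚ.+-identityˡ _) ⟩
    0ℤ + w (u ℕ.+ d ℕ.* 0)               ≡⟨ cong (_+_ 0ℤ) (sym (*-identityˡ (w (u ℕ.+ d ℕ.* 0)))) ⟩
    0ℤ + 1ℤ * w (u ℕ.+ d ℕ.* 0)          ∎
    where open ≡-Reasoning
  Δ∘ⁿ-expansion d (suc n) w u = begin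
    (Δ[ d ] ∘ⁿ n) w (u ℕ.+ d) - (Δ[ d ] ∘ⁿ n) w u
      ≡⟨ cong₂ _-_ (Δ∘ⁿ-expansion d n w (u ℕ.+ d)) (Δ∘ⁿ-expansion d n w u) ⟩
    Σ< (suc n) (λ i → a i * w (u ℕ.+ d ℕ.+ d ℕ.* i)) - Σ< (suc n) (λ i → a i * g i)
      ≡⟨ cong₂ _-_ (Σ<-cong (suc n) (λ i _ → cong (λ v → a i * w v) (shift i)))
                   (sym (trans (cong (_+_ (Σ< (suc n) (λ i → a i * g i))) top-vanishes) (ℤₚ.+-identityʳ _))) ⟩
    Σ< (suc n) (λ i → a i * g (suc i)) - Σ< (suc (suc n)) (λ i → a i * g i)
      ≡⟨ sym (Σ<-[x-1]* (suc n) a g) ⟩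
    Σ< (suc (suc n)) (λ i → [x-1]^ (suc n) i * g i)
      ∎
    where
    open ≡-Reasoning
    a = [x-1]^ n
    g : ℕ → ℤ
    g i = w (u ℕ.+ d ℕ.* i)
    shift : ∀ i → u ℕ.+ d ℕ.+ d ℕ.* i ≡ u ℕ.+ d ℕ.* suc i
    shift i = trans (+-assoc u d (d ℕ.* i)) (cong (u ℕ.+_) (sym (*-suc d i)))
    top-vanishes : a (suc n) * g (suc n) ≡ 0ℤ
    top-vanishes = cong (_* g (suc n)) ([x-1]^-vanishes n (suc n) (n<1+n n))

  Δ∘ⁿ-geometric : ∀ n x u → (Δ ∘ⁿ n) (x ^_) u ≡ (x - 1ℤ) ^ n * x ^ u
  Δ∘ⁿ-geometric zero    x u = sym (*-identityˡ (x ^ u))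
  Δ∘ⁿ-geometric (suc n) x u = begin
    (Δ ∘ⁿ n) (x ^_) (u ℕ.+ 1) - (Δ ∘ⁿ n) (x ^_) u
      ≡⟨ cong₂ _-_ (Δ∘ⁿ-geometric n x (u ℕ.+ 1)) (Δ∘ⁿ-geometric n x u) ⟩
    (x - 1ℤ) ^ n * x ^ (u ℕ.+ 1) - (x - 1ℤ) ^ n * x ^ u
      ≡⟨ cong (λ y → (x - 1ℤ) ^ n * y - (x - 1ℤ) ^ n * x ^ u) (^-distribˡ-+-* x u 1) ⟩
    (x - 1ℤ) ^ n * (x ^ u * (x * 1ℤ)) - (x - 1ℤ) ^ n * x ^ u
      ≡⟨ regroup ((x - 1ℤ) ^ n) (x ^ u) x ⟩
    (x - 1ℤ) * (x - 1ℤ) ^ n * x ^ u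
      ∎
    where
    open ≡-Reasoning
    regroup : ∀ c a x → c * (a * (x * 1ℤ)) - c * a ≡ (x - 1ℤ) * c * a
    regroup = solve-∀

  module _ (n : ℕ) where
    open Congruence n

    Δ-cong-≈ : ∀ d {v w : Seq} → v ≈ₛ w → Δ[ d ] v ≈ₛ Δ[ d ] w
    Δ-cong-≈ d v≈w u = -‿cong₂ (v≈w (u ℕ.+ d)) (v≈w u)

    ∘ⁿ-≈ : ∀ k (F G : Seq → Seq) → (∀ w → F w ≈ₛ G w) →
           (∀ {v w} → v ≈ₛ w → G v ≈ₛ G w) → ∀ w → (F ∘ⁿ k) w ≈ₛ (G ∘ⁿ k) w
    ∘ⁿ-≈ zero    F G F≈G G-cong w u = ≈-refl
    ∘ⁿ-≈ (suc k) F G F≈G G-cong w u =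
      ≈-trans (F≈G ((F ∘ⁿ k) w) u) (G-cong (∘ⁿ-≈ k F G F≈G G-cong w) u)

    ∘ⁿ-cong-≈ : ∀ k (F : Seq → Seq) → (∀ {v w} → v ≈ₛ w → F v ≈ₛ F w) →
                ∀ {v w} → v ≈ₛ w → (F ∘ⁿ k) v ≈ₛ (F ∘ⁿ k) w
    ∘ⁿ-cong-≈ zero    F F-cong v≈w = v≈w
    ∘ⁿ-cong-≈ (suc k) F F-cong v≈w = F-cong (∘ⁿ-cong-≈ k F F-cong v≈w)

module Polynomials where

  open import Data.Nat.Base as ℕ using (ℕ; zero; suc; _!)
  open import Data.Integer.Base using (ℤ; +_; _+_; _*_; _-_; -_; 0ℤ; 1ℤ; _^_)
  open import Data.Integer.Properties using (pos-+; pos-*; *-zeroʳ; *-assoc; +-inverseʳ; i-j≡0⇒i≡j)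
  open import Data.Integer.Tactic.RingSolver using (solve-∀)
  open import Data.Product.Base using (∃; _,_)
  open import Relation.Binary.PropositionalEquality

  open Differences

  Deg< : ℕ → Seq → Set
  Deg< zero    f = ∀ u → f u ≡ 0ℤ
  Deg< (suc n) f = ∃ λ c → Deg< n (λ u → f u - c * (+ u) ^ n)

  LeadingTerm : ℕ → ℤ → Seq → Set
  LeadingTerm n c f = Deg< n (λ u → f u - c * (+ u) ^ n)

  Deg<-cong : ∀ n {f g : Seq} → Deg< n f → f ≗ g → Deg< n g
  Deg<-cong zero    f≡0     f≗g u = trans (sym (f≗g u)) (f≡0 u)
  Deg<-cong (suc n) (c , d) f≗g   = c , Deg<-cong n d (λ u → cong (_- c * (+ u) ^ n) (f≗g u))

  Deg<-zero : ∀ n → Deg< n (λ _ → 0ℤ)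
  Deg<-zero zero    u = refl
  Deg<-zero (suc n)   = 0ℤ , Deg<-cong n (Deg<-zero n) (λ u → sym (zero-term ((+ u) ^ n)))
    where
    zero-term : ∀ x → 0ℤ - 0ℤ * x ≡ 0ℤ
    zero-term = solve-∀

  Deg<-suc : ∀ n {f} → Deg< n f → Deg< (suc n) f
  Deg<-suc n {f} d = 0ℤ , Deg<-cong n d (λ u → sym (zero-term (f u) ((+ u) ^ n)))
    where
    zero-term : ∀ y x → y - 0ℤ * x ≡ y
    zero-term = solve-∀

  Deg<-+ : ∀ n {f g} → Deg< n f → Deg< n g → Deg< n (λ u → f u + g u)
  Deg<-+ zero    f≡0     g≡0      u = cong₂ _+_ (f≡0 u) (g≡0 u)
  Deg<-+ (suc n) {f} {g} (c , d) (c′ , d′) =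
    c + c′ , Deg<-cong n (Deg<-+ n d d′) (λ u → regroup (f u) (g u) c c′ ((+ u) ^ n))
    where
    regroup : ∀ a b c c′ x → a - c * x + (b - c′ * x) ≡ a + b - (c + c′) * x
    regroup = solve-∀

  Deg<-* : ∀ n k {f} → Deg< n f → Deg< n (λ u → k * f u)
  Deg<-* zero    k f≡0 u = trans (cong (k *_) (f≡0 u)) (*-zeroʳ k)
  Deg<-* (suc n) k {f} (c , d) =
    k * c , Deg<-cong n (Deg<-* n k d) (λ u → regroup k (f u) c ((+ u) ^ n))
    where
    regroup : ∀ k a c x → k * (a - c * x) ≡ k * a - k * c * x
    regroup = solve-∀

  Deg<-pow : ∀ n → Deg< (suc n) (λ u → (+ u) ^ n)
  Deg<-pow n = 1ℤ , Deg<-cong n (Deg<-zero n) (λ u → sym (cancel ((+ u) ^ n)))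
    where
    cancel : ∀ x → x - 1ℤ * x ≡ 0ℤ
    cancel = solve-∀

  Deg<-*u : ∀ n {f} → Deg< n f → Deg< (suc n) (λ u → + u * f u)
  Deg<-*u zero    {f} f≡0     = 0ℤ , λ u → trans (cong (λ y → + u * y - 0ℤ * 1ℤ) (f≡0 u)) (vanish (+ u))
    where
    vanish : ∀ x → x * 0ℤ - 0ℤ * 1ℤ ≡ 0ℤ
    vanish = solve-∀
  Deg<-*u (suc n) {f} (c , d) = c , Deg<-cong (suc n) (Deg<-*u n d) (λ u → regroup (+ u) (f u) c ((+ u) ^ n))
    where
    regroup : ∀ x a c y → x * (a - c * y) ≡ x * a - c * (x * y)
    regroup = solve-∀

  binomial-tail : ℕ → Seq
  binomial-tail n u = (+ u + 1ℤ) ^ suc n - (+ u) ^ suc n - + suc n * (+ u) ^ n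

  binomial-tail-suc : ∀ n u →
    binomial-tail (suc n) u ≡ + u * binomial-tail n u + binomial-tail n u + + suc n * (+ u) ^ n
  binomial-tail-suc n u = expand (+ u) ((+ u + 1ℤ) ^ n) ((+ u) ^ n) (+ n)
    where
    expand : ∀ x a b k →
      (x + 1ℤ) * ((x + 1ℤ) * a) - x * (x * b) - (1ℤ + (1ℤ + k)) * (x * b) ≡
      x * ((x + 1ℤ) * a - x * b - (1ℤ + k) * b) + ((x + 1ℤ) * a - x * b - (1ℤ + k) * b) + (1ℤ + k) * b
    expand = solve-∀

  Deg<-binomial-tail : ∀ n → Deg< n (binomial-tail n)
  Deg<-binomial-tail zero    u = vanish (+ u)
    where
    vanish : ∀ x → (x + 1ℤ) * 1ℤ - x * 1ℤ - 1ℤ * 1ℤ ≡ 0ℤ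
    vanish = solve-∀
  Deg<-binomial-tail (suc n)   = Deg<-cong (suc n)
    (Deg<-+ (suc n) {f = λ u → + u * T u + T u} {g = λ u → + suc n * (+ u) ^ n}
      (Deg<-+ (suc n) {f = λ u → + u * T u} {g = T} (Deg<-*u n {T} tail) (Deg<-suc n {T} tail))
      (Deg<-* (suc n) (+ suc n) {λ u → (+ u) ^ n} (Deg<-pow n)))
    (λ u → sym (binomial-tail-suc n u))
    where
    T = binomial-tail n
    tail = Deg<-binomial-tail n

  mutual
    Δ-leading : ∀ n c {f} → LeadingTerm (suc n) c f → LeadingTerm n (c * + suc n) (Δ f)
    Δ-leading n c {f} lower = Deg<-cong n
      (Deg<-+ n {f = λ u → c * binomial-tail n u} {g = Δ g}
        (Deg<-* n c {binomial-tail n} (Deg<-binomial-tail n)) (Δ-Deg< n {g} lower))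
      (λ u → trans (cong (λ y → c * (y ^ suc n - (+ u) ^ suc n - + suc n * (+ u) ^ n) + Δ g u) (sym (pos-+ u 1)))
                   (regroup c (f (u ℕ.+ 1)) (f u) ((+ (u ℕ.+ 1)) ^ suc n) ((+ u) ^ suc n) ((+ u) ^ n) (+ suc n)))
      where
      g : Seq
      g u = f u - c * (+ u) ^ suc n
      regroup : ∀ c a b y x z k → c * (y - x - k * z) + (a - c * y - (b - c * x)) ≡ a - b - c * k * z
      regroup = solve-∀

    Δ-Deg< : ∀ n {f} → Deg< (suc n) f → Deg< n (Δ f)
    Δ-Deg< zero    {f} (c , f≡c) u =
      trans (cong₂ _-_ (i-j≡0⇒i≡j (f (u ℕ.+ 1)) (c * 1ℤ) (f≡c (u ℕ.+ 1)))
                       (i-j≡0⇒i≡j (f u) (c * 1ℤ) (f≡c u)))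
            (+-inverseʳ (c * 1ℤ))
    Δ-Deg< (suc n) {f} (c , lower) = c * + suc n , Δ-leading n c {f} lower

  Δ∘ⁿ-leading : ∀ n c f → LeadingTerm n c f → ∀ u → (Δ ∘ⁿ n) f u ≡ c * + (n !)
  Δ∘ⁿ-leading zero    c f f≡c u = i-j≡0⇒i≡j (f u) (c * 1ℤ) (f≡c u)
  Δ∘ⁿ-leading (suc n) c f lower u = begin
    (Δ ∘ⁿ suc n) f u              ≡⟨ cong (λ g → g u) (∘ⁿ-sucʳ Δ n f) ⟩
    (Δ ∘ⁿ n) (Δ f) u              ≡⟨ Δ∘ⁿ-leading n (c * + suc n) (Δ f) (Δ-leading n c {f} lower) u ⟩
    c * + suc n * + (n !)         ≡⟨ *-assoc c (+ suc n) (+ (n !)) ⟩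
    c * (+ suc n * + (n !))       ≡⟨ cong (c *_) (sym (pos-* (suc n) (n !))) ⟩
    c * + (suc n !)               ∎
    where open ≡-Reasoning

  Δ∘ⁿ-beyond-degree : ∀ n c f → LeadingTerm n c f → ∀ u → (Δ ∘ⁿ suc n) f u ≡ 0ℤ
  Δ∘ⁿ-beyond-degree n c f lower u =
    trans (cong₂ _-_ (Δ∘ⁿ-leading n c f lower (u ℕ.+ 1)) (Δ∘ⁿ-leading n c f lower u))
          (+-inverseʳ (c * + (n !)))

module Primes where

  open import Data.Nat.Base as ℕ using (ℕ; zero; suc; _<_; _!; _^_; NonZero; nonTrivial⇒n>1)
  open import Data.Nat.Properties using (<⇒≱; <-trans; n<1+n)
  open import Data.Nat.Divisibility using (_∣_; ∣⇒≤; ∣-trans; ∣-refl; ∣1⇒≡1)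
  open import Data.Nat.Primality using (Prime; euclidsLemma; prime⇒nonTrivial; prime⇒irreducible)
  open import Data.Nat.Coprimality using (Coprime; coprime-divisor)
  open import Data.Integer.Base as ℤ using (ℤ; +_; _*_)
  open import Data.Integer.Properties using (abs-*)
  open import Data.Integer.Divisibility.Signed as ℤ using (∣⇒∣ᵤ; ∣ᵤ⇒∣)
  open import Data.Sum.Base using (_⊎_; inj₁; inj₂; map)
  open import Data.Product.Base using (_,_)
  open import Relation.Binary.PropositionalEquality using (subst; refl)
  open import Relation.Nullary.Negation using (¬_; contradiction)

  module _ {p} (p-prime : Prime p) where

    prime∤0<n<p : ∀ {n} → n < p → .{{NonZero n}} → ¬ p ∣ n
    prime∤0<n<p n<p p∣n = <⇒≱ n<p (∣⇒≤ p∣n)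

    prime∤1 : ¬ p ∣ 1
    prime∤1 = prime∤0<n<p (nonTrivial⇒n>1 p {{prime⇒nonTrivial p-prime}})

    prime∤! : ∀ n → n < p → ¬ p ∣ n !
    prime∤! zero    _   = prime∤1
    prime∤! (suc n) n<p p∣n! with euclidsLemma (suc n) (n !) p-prime p∣n!
    ... | inj₁ p∣suc-n = prime∤0<n<p n<p p∣suc-n
    ... | inj₂ p∣n!    = prime∤! n (<-trans (n<1+n n) n<p) p∣n!

    euclidsLemma-ℤ : ∀ x y → + p ℤ.∣ x * y → + p ℤ.∣ x ⊎ + p ℤ.∣ y
    euclidsLemma-ℤ x y p∣xy =
      map ∣ᵤ⇒∣ ∣ᵤ⇒∣ (euclidsLemma ℤ.∣ x ∣ ℤ.∣ y ∣ p-prime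
                                  (subst (p ∣_) (abs-* x y) (∣⇒∣ᵤ p∣xy)))

    ¬∣⇒coprime : ∀ {k} → ¬ p ∣ k → Coprime k p
    ¬∣⇒coprime p∤k (i∣k , i∣p) with prime⇒irreducible p-prime i∣p
    ... | inj₁ i≡1 = i≡1
    ... | inj₂ refl = contradiction i∣k p∤k

    ¬∣⇒coprime-^ : ∀ {k} n → ¬ p ∣ k → Coprime k (p ^ n)
    ¬∣⇒coprime-^ zero    p∤k     (_ , i∣1)         = ∣1⇒≡1 i∣1
    ¬∣⇒coprime-^ (suc n) p∤k {i} (i∣k , i∣p^suc-n) =
      ¬∣⇒coprime-^ n p∤k (i∣k , coprime-divisor i⊥p i∣p^suc-n)
      where
      i⊥p : Coprime i p
      i⊥p (j∣i , j∣p) = ¬∣⇒coprime p∤k (∣-trans j∣i i∣k , j∣p)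

    coprime⇒¬∣ : ∀ {k n} → Coprime k n → p ∣ n → ¬ p ∣ k
    coprime⇒¬∣ k⊥n p∣n p∣k = prime∤1 (subst (p ∣_) (k⊥n (p∣k , p∣n)) ∣-refl)

module Arithmetic where

  open import Data.Nat.Base using (ℕ; zero; suc; _+_; _*_; _∸_; _^_; s≤s; NonZero)
  open import Data.Nat.Properties using (m+n∸m≡n)
  open import Data.Nat.DivMod
    using ( _/_; _%_; m≡m%n+[m/n]*n; m%n<n; m∣n⇒o%n%m≡o%m; m*n/n≡m; m%[n*o]/o≡m/o%n
          ; +-distrib-/-∣ʳ; %-distribˡ-+; m%n%n≡m%n)
  open import Data.Nat.Divisibility using (_∣_; m%n≡0⇒n∣m; n∣m*n)
  open import Data.Nat.Tactic.RingSolver using (solve-∀)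
  open import Data.Product.Base using (∃; _,_)
  open import Relation.Binary.PropositionalEquality
  open import Relation.Nullary.Negation using (¬_; contradiction)

  odd⇒≡1+[/2]*2 : ∀ n → ¬ 2 ∣ n → n ≡ suc (n / 2 * 2)
  odd⇒≡1+[/2]*2 n ¬2∣n with n % 2 in n%2≡r | m%n<n n 2
  ... | 0           | _               = contradiction (m%n≡0⇒n∣m n 2 n%2≡r) ¬2∣n
  ... | 1           | _               = trans (m≡m%n+[m/n]*n n 2) (cong (_+ n / 2 * 2) n%2≡r)
  ... | suc (suc _) | s≤s (s≤s ())

  choose2 : ℕ → ℕ
  choose2 zero    = 0
  choose2 (suc n) = choose2 n + n

  choose2-odd : ∀ k → choose2 (suc (k * 2)) ≡ suc (k * 2) * k
  choose2-odd zero    = refl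
  choose2-odd (suc k) = begin
    choose2 (suc (k * 2)) + suc (k * 2) + suc (suc (k * 2))
      ≡⟨ cong (λ c → c + suc (k * 2) + suc (suc (k * 2))) (choose2-odd k) ⟩
    suc (k * 2) * k + suc (k * 2) + suc (suc (k * 2))
      ≡⟨ regroup k ⟩
    suc (suc k * 2) * suc k
      ∎
    where
    open ≡-Reasoning
    regroup : ∀ k → suc (k * 2) * k + suc (k * 2) + suc (suc (k * 2)) ≡ suc (suc k * 2) * suc k
    regroup = solve-∀

  [1+y]^n-expansion : ∀ n y → ∃ λ Z → (1 + y) ^ n ≡ 1 + n * y + choose2 n * (y * y) + y * y * y * Z
  [1+y]^n-expansion zero    y = 0 , base y
    where
    base : ∀ y → 1 ≡ 1 + 0 * y + 0 * (y * y) + y * y * y * 0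
    base = solve-∀
  [1+y]^n-expansion (suc n) y with [1+y]^n-expansion n y
  ... | Z , [1+y]^n≡ = choose2 n + Z + y * Z , trans (cong ((1 + y) *_) [1+y]^n≡) (step n y (choose2 n) Z)
    where
    step : ∀ n y c Z → (1 + y) * (1 + n * y + c * (y * y) + y * y * y * Z)
                     ≡ 1 + suc n * y + (c + n) * (y * y) + y * y * y * (c + Z + y * Z)
    step = solve-∀

  [1+y]^n≡1+y* : ∀ n y → ∃ λ T → (1 + y) ^ n ≡ 1 + y * T
  [1+y]^n≡1+y* n y with [1+y]^n-expansion n y
  ... | Z , [1+y]^n≡ = n + choose2 n * y + y * y * Z , trans [1+y]^n≡ (factor n y (choose2 n) Z)
    where
    factor : ∀ n y c Z → 1 + n * y + c * (y * y) + y * y * y * Z ≡ 1 + y * (n + c * y + y * y * Z)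
    factor = solve-∀

  [x+y]^suc-n-expansion : ∀ n x y → ∃ λ Z → (x + y) ^ suc n ≡ x ^ suc n + suc n * x ^ n * y + y * y * Z
  [x+y]^suc-n-expansion zero    x y = 0 , base x y
    where
    base : ∀ x y → (x + y) * 1 ≡ x * 1 + 1 * 1 * y + y * y * 0
    base = solve-∀
  [x+y]^suc-n-expansion (suc n) x y with [x+y]^suc-n-expansion n x y
  ... | Z , [x+y]^n≡ = suc n * x ^ n + x * Z + y * Z , trans (cong ((x + y) *_) [x+y]^n≡) (step n x y (x ^ n) Z)
    where
    step : ∀ n x y a Z → (x + y) * (x * a + suc n * a * y + y * y * Z)
                       ≡ x * (x * a) + suc (suc n) * (x * a) * y + y * y * (suc n * a + x * Z + y * Z)
    step = solve-∀

  [x%ab∸x%b]/b≡x/b%a : ∀ x a b .{{_ : NonZero a}} .{{_ : NonZero b}} {{_ : NonZero (a * b)}} →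
                       (x % (a * b) ∸ x % b) / b ≡ x / b % a
  [x%ab∸x%b]/b≡x/b%a x a b = begin
    (y ∸ x % b) / b              ≡⟨ cong (λ r → (y ∸ r) / b) (sym (m∣n⇒o%n%m≡o%m b (a * b) x (n∣m*n a))) ⟩
    (y ∸ y % b) / b              ≡⟨ cong (_/ b) (m∸m%n≡m/n*n y b) ⟩
    y / b * b / b                ≡⟨ m*n/n≡m (y / b) b ⟩
    y / b                        ≡⟨ m%[n*o]/o≡m/o%n x a b ⟩
    x / b % a                    ∎
    where
    open ≡-Reasoning
    y = x % (a * b)
    m∸m%n≡m/n*n : ∀ m n .{{_ : NonZero n}} → m ∸ m % n ≡ m / n * n
    m∸m%n≡m/n*n m n = trans (cong (_∸ m % n) (m≡m%n+[m/n]*n m n)) (m+n∸m≡n (m % n) _)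

  [m+kn]/n≡m/n+k : ∀ m k n .{{_ : NonZero n}} → (m + k * n) / n ≡ m / n + k
  [m+kn]/n≡m/n+k m k n = trans (+-distrib-/-∣ʳ m (n∣m*n k)) (cong (m / n +_) (m*n/n≡m k n))

  [m%n+k]%n≡[m+k]%n : ∀ m k n .{{_ : NonZero n}} → (m % n + k) % n ≡ (m + k) % n
  [m%n+k]%n≡[m+k]%n m k n = begin
    (m % n + k) % n              ≡⟨ %-distribˡ-+ (m % n) k n ⟩
    (m % n % n + k % n) % n      ≡⟨ cong (λ r → (r + k % n) % n) (m%n%n≡m%n m n) ⟩
    (m % n + k % n) % n          ≡⟨ sym (%-distribˡ-+ m k n) ⟩
    (m + k) % n                  ∎
    where open ≡-Reasoning

module Recurrences {p : ℕ} (p-prime : Prime p) where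

  open import Data.Nat.Base as ℕ using (zero; suc)
  open import Data.Nat.Properties using (+-comm; +-assoc; +-suc)
  import Data.Nat.Properties as ℕₚ
  open import Data.Integer.Base using (ℤ; +_; _+_; _*_; _-_; -_; 0ℤ; 1ℤ)
  open import Data.Integer.Properties using (+-identityˡ; +-identityʳ; neg-distribˡ-*)
  open import Data.Integer.Divisibility.Signed using (∣m⇒∣m*n) renaming (_∣_ to _∣ℤ_)
  open import Data.Integer.Tactic.RingSolver using (solve-∀)
  open import Data.Sum.Base using (_⊎_; [_,_]′; map)
  open import Relation.Binary.PropositionalEquality

  open Sums
  open Differences
  open Primes

  open Congruence p

  Vanishes : Seq → Set
  Vanishes w = ∀ u → w u ≈ 0ℤ

  Recurrence : ℕ → (ℕ → ℤ) → Seq → Set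
  Recurrence l c w = ∀ u → w (u ℕ.+ l) ≈ Σ< l (λ i → c i * w (u ℕ.+ i))

  Δ-vanishes : ∀ {w} → Vanishes w → Vanishes (Δ w)
  Δ-vanishes w≈0 u = -‿cong₂ (w≈0 (u ℕ.+ 1)) (w≈0 u)

  Δ∘ⁿ-vanishes : ∀ k {w} → Vanishes w → Vanishes ((Δ ∘ⁿ k) w)
  Δ∘ⁿ-vanishes zero        w≈0 = w≈0
  Δ∘ⁿ-vanishes (suc k) {w} w≈0 = Δ-vanishes {(Δ ∘ⁿ k) w} (Δ∘ⁿ-vanishes k w≈0)

  Δ-recurrence : ∀ l c {w} → Recurrence l c w → Recurrence l c (Δ w)
  Δ-recurrence l c {w} rec u = begin
    w (u ℕ.+ l ℕ.+ 1) - w (u ℕ.+ l)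
      ≡⟨ cong (λ v → w v - w (u ℕ.+ l)) (+-comm (u ℕ.+ l) 1) ⟩
    w (suc u ℕ.+ l) - w (u ℕ.+ l)
      ≈⟨ -‿cong₂ (rec (suc u)) (rec u) ⟩
    Σ< l (λ i → c i * w (suc u ℕ.+ i)) - Σ< l (λ i → c i * w (u ℕ.+ i))
      ≡⟨ sym (Σ<-minus l _ _) ⟩
    Σ< l (λ i → c i * w (suc u ℕ.+ i) - c i * w (u ℕ.+ i))
      ≡⟨ Σ<-cong l (λ i _ → trans (factor (c i) _ _) (cong (λ v → c i * (w v - w (u ℕ.+ i))) (+-comm 1 (u ℕ.+ i))))
      ⟩
    Σ< l (λ i → c i * Δ w (u ℕ.+ i))
      ∎
    where
    open ≈-Reasoning
    factor : ∀ c x y → c * x - c * y ≡ c * (x - y)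
    factor = solve-∀

  Δ∘ⁿ-recurrence : ∀ k l c {w} → Recurrence l c w → Recurrence l c ((Δ ∘ⁿ k) w)
  Δ∘ⁿ-recurrence zero    l c     rec = rec
  Δ∘ⁿ-recurrence (suc k) l c {w} rec = Δ-recurrence l c {(Δ ∘ⁿ k) w} (Δ∘ⁿ-recurrence k l c rec)

  Δ-vanishes⇒constant : ∀ {v} → Vanishes (Δ v) → ∀ u → v u ≈ v 0
  Δ-vanishes⇒constant     Δv≈0 zero    = ≈-refl
  Δ-vanishes⇒constant {v} Δv≈0 (suc u) = begin
    v (suc u)                    ≡⟨ cong v (+-comm 1 u) ⟩
    v (u ℕ.+ 1)                  ≡⟨ sym (cancel (v (u ℕ.+ 1)) (v u)) ⟩
    Δ v u + v u                  ≈⟨ +-cong (Δv≈0 u) ≈-refl ⟩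
    0ℤ + v u                     ≡⟨ +-identityˡ (v u) ⟩
    v u                          ≈⟨ Δ-vanishes⇒constant {v} Δv≈0 u ⟩
    v 0                          ∎
    where
    open ≈-Reasoning
    cancel : ∀ a b → a - b + b ≡ a
    cancel = solve-∀

  -- Dividing the characteristic polynomial of a recurrence by x − 1, which is
  -- possible when its coefficients sum to 1.
  Δ-recurrence-shortened : ∀ l c {w} → Recurrence (suc l) c w → Σ< (suc l) c ≈ 1ℤ →
                           Recurrence l (λ i → - Σ< (suc i) c) (Δ w)
  Δ-recurrence-shortened l c {w} rec Σc≈1 u = begin
    Δ w (u ℕ.+ l)
      ≡⟨ cong (λ v → w v - W l) (trans (+-assoc u l 1) (cong (u ℕ.+_) (+-comm l 1))) ⟩
    w (u ℕ.+ suc l) - W l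
      ≈⟨ -‿cong₂ (rec u) ≈-refl ⟩
    B + c l * W l - W l
      ≡⟨ regroup A B (c l) (W l) ⟩
    - (A * W l - B) + (A + c l - 1ℤ) * W l
      ≈⟨ +-cong (≈-refl { - (A * W l - B)}) (∣⇒≈0 (∣m⇒∣m*n (W l) (divides-difference Σc≈1))) ⟩
    - (A * W l - B) + 0ℤ
      ≡⟨ +-identityʳ _ ⟩
    - (A * W l - B)
      ≡⟨ cong -_ (sym (Σ<-summation-by-parts l c W)) ⟩
    - Σ< l (λ i → Σ< (suc i) c * (W (suc i) - W i))
      ≡⟨ sym (Σ<-neg l _) ⟩
    Σ< l (λ i → - (Σ< (suc i) c * (W (suc i) - W i)))
      ≡⟨ Σ<-cong l (λ i _ → trans (neg-distribˡ-* (Σ< (suc i) c) _)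
                                  (cong (λ v → - Σ< (suc i) c * (w v - W i)) (index i))) ⟩
    Σ< l (λ i → - Σ< (suc i) c * Δ w (u ℕ.+ i))
      ∎
    where
    open ≈-Reasoning
    W : ℕ → ℤ
    W i = w (u ℕ.+ i)
    A = Σ< l c
    B = Σ< l (λ i → c i * W i)
    index : ∀ i → u ℕ.+ suc i ≡ u ℕ.+ i ℕ.+ 1
    index i = trans (+-suc u i) (+-comm 1 (u ℕ.+ i))
    regroup : ∀ A B cₗ wₗ → B + cₗ * wₗ - wₗ ≡ - (A * wₗ - B) + (A + cₗ - 1ℤ) * wₗ
    regroup = solve-∀

  ≈-fixed-point : ∀ s x → x ≈ s * x → s ≈ 1ℤ ⊎ x ≈ 0ℤ
  ≈-fixed-point s x x≈sx =
    map (λ p∣1-s → ≈-sym (mk≈ p∣1-s)) ∣⇒≈0 (euclidsLemma-ℤ p-prime (1ℤ - s) x p∣[1-s]x)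
    where
    factor : ∀ x s → x - s * x ≡ (1ℤ - s) * x
    factor = solve-∀
    p∣[1-s]x : + p ∣ℤ (1ℤ - s) * x
    p∣[1-s]x = subst (+ p ∣ℤ_) (factor x s) (divides-difference x≈sx)

  -- Induction on l and k: by induction for Δ w, Δˡ⁺¹ w is constant, and the recurrence makes
  -- that constant a fixed point of multiplication by Σ c. Either it vanishes, or Σ c ≡ 1 and
  -- Δ w satisfies a recurrence of length l.
  Δ∘ⁿ-vanishes-at-recurrence-length : ∀ l c {w} → Recurrence l c w →
    ∀ k → Vanishes ((Δ ∘ⁿ k) w) → Vanishes ((Δ ∘ⁿ l) w)
  Δ∘ⁿ-vanishes-at-recurrence-length zero    c {w} rec k       _    u =
    ≈-trans (≈-reflexive (cong w (sym (ℕₚ.+-identityʳ u)))) (rec u)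
  Δ∘ⁿ-vanishes-at-recurrence-length (suc l) c     rec zero    w≈0    = Δ∘ⁿ-vanishes (suc l) w≈0
  Δ∘ⁿ-vanishes-at-recurrence-length (suc l) c {w} rec (suc k) Δᵏ⁺¹w≈0 =
    [ shortened , (λ v₀≈0 u → ≈-trans (v-constant u) v₀≈0) ]′
      (≈-fixed-point (Σ< (suc l) c) (v 0) v₀-fixed)
    where
    Δᵏ[Δw]≈0 : Vanishes ((Δ ∘ⁿ k) (Δ w))
    Δᵏ[Δw]≈0 = subst Vanishes (∘ⁿ-sucʳ Δ k w) Δᵏ⁺¹w≈0
    v : Seq
    v = (Δ ∘ⁿ suc l) w
    Δv≈0 : Vanishes (Δ v)
    Δv≈0 = subst Vanishes (sym (∘ⁿ-sucʳ Δ (suc l) w))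
             (Δ∘ⁿ-vanishes-at-recurrence-length (suc l) c {Δ w} (Δ-recurrence (suc l) c {w} rec) k Δᵏ[Δw]≈0)
    v-constant : ∀ u → v u ≈ v 0
    v-constant = Δ-vanishes⇒constant {v} Δv≈0
    v₀-fixed : v 0 ≈ Σ< (suc l) c * v 0
    v₀-fixed = begin
      v 0                                 ≈⟨ ≈-sym (v-constant (suc l)) ⟩
      v (suc l)                           ≈⟨ Δ∘ⁿ-recurrence (suc l) (suc l) c {w} rec 0 ⟩
      Σ< (suc l) (λ i → c i * v i)        ≈⟨ Σ<-cong-≈ (suc l) (λ i _ → *-congˡ (c i) (v-constant i)) ⟩
      Σ< (suc l) (λ i → c i * v 0)        ≡⟨ Σ<-*ʳ (suc l) c (v 0) ⟩
      Σ< (suc l) c * v 0                  ∎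
      where open ≈-Reasoning
    shortened : Σ< (suc l) c ≈ 1ℤ → Vanishes v
    shortened Σc≈1 = subst Vanishes (sym (∘ⁿ-sucʳ Δ l w))
      (Δ∘ⁿ-vanishes-at-recurrence-length l (λ i → - Σ< (suc i) c) {Δ w}
        (Δ-recurrence-shortened l c {w} rec Σc≈1) k Δᵏ[Δw]≈0)

module Frobenius (m : ℕ) (p-prime : Prime (suc (suc m))) (p-odd : ¬ 2 ∣ suc (suc m)) where

  open import Data.Nat.Base as ℕ using (zero; _<_; _^_; s≤s)
  open import Data.Nat.Properties using (*-zeroʳ; +-identityʳ; *-comm; *-identityˡ; m^n≡0⇒m≡0)
  open import Data.Nat.DivMod using (_/_)
  open import Data.Nat.Divisibility using (_∣0; divides)
  import Data.Integer.Properties as ℤₚ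
  open import Data.Integer.Base as ℤ using (ℤ; +_; _+_; _*_; _-_; -_; 0ℤ; 1ℤ; -1ℤ)
  open import Data.Integer.Divisibility.Signed
    using (∣⇒∣ᵤ; ∣m⇒∣m*n) renaming (divides to dividesℤ; _∣_ to _∣ℤ_)
  open import Data.Integer.Tactic.RingSolver using (solve-∀)
  open import Data.Sum.Base using (inj₁; inj₂)
  open import Data.Product.Base using (∃; _,_)
  open import Relation.Binary.PropositionalEquality
  open import Relation.Nullary.Negation using (contradiction)

  open Sums
  open Differences
  open Primes
  open Arithmetic using (odd⇒≡1+[/2]*2)

  -- The odd prime is written p = suc (suc m), so that p − 2 = m and p − 1 = suc m need no
  -- truncated subtraction; the same convention is used in the modules below.
  p : ℕ
  p = suc (suc m)

  open Congruence p

  p∣[x-1]^p : ∀ i → suc i < p → + p ∣ℤ [x-1]^ p (suc i)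
  p∣[x-1]^p i i<p with euclidsLemma-ℤ p-prime (+ suc i) ([x-1]^ p (suc i))
                         (dividesℤ ([x-1]^ (suc m) i) (trans ([x-1]^-derivative (suc m) i) (ℤₚ.*-comm (+ p) _)))
  ... | inj₁ p∣suc-i = contradiction (∣⇒∣ᵤ p∣suc-i) (prime∤0<n<p p-prime i<p)
  ... | inj₂ p∣coeff = p∣coeff

  [x-1]^p-constant : [x-1]^ p 0 ≡ -1ℤ
  [x-1]^p-constant =
    trans (cong (λ n → [x-1]^ n 0) (odd⇒≡1+[/2]*2 p p-odd)) ([x-1]^-constant-odd (p / 2))

  Δ∘ⁿp≈Δ[*p] : ∀ d (w : Seq) → (Δ[ d ] ∘ⁿ p) w ≈ₛ Δ[ d ℕ.* p ] w
  Δ∘ⁿp≈Δ[*p] d w u = begin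
    (Δ[ d ] ∘ⁿ p) w u                    ≡⟨ Δ∘ⁿ-expansion d p w u ⟩
    Σ< (suc p) f                         ≡⟨ cong (_+ f p) (Σ<-suc (suc m) f) ⟩
    f 0 + Σ< (suc m) (λ i → f (suc i)) + f p
      ≈⟨ +-cong (+-cong (≈-refl {f 0}) (Σ<-≈0 (suc m) middle-vanishes)) (≈-refl {f p}) ⟩
    f 0 + 0ℤ + f p
      ≡⟨ cong₂ (λ a b → a * w (u ℕ.+ d ℕ.* 0) + 0ℤ + b * w (u ℕ.+ d ℕ.* p)) [x-1]^p-constant ([x-1]^-leading p) ⟩
    -1ℤ * w (u ℕ.+ d ℕ.* 0) + 0ℤ + 1ℤ * w (u ℕ.+ d ℕ.* p)
      ≡⟨ cong (λ v → -1ℤ * w v + 0ℤ + 1ℤ * w (u ℕ.+ d ℕ.* p)) (trans (cong (u ℕ.+_) (*-zeroʳ d)) (+-identityʳ u))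
      ⟩
    -1ℤ * w u + 0ℤ + 1ℤ * w (u ℕ.+ d ℕ.* p)
      ≡⟨ regroup (w u) (w (u ℕ.+ d ℕ.* p)) ⟩
    Δ[ d ℕ.* p ] w u                     ∎
    where
    open ≈-Reasoning
    f : ℕ → ℤ
    f i = [x-1]^ p i * w (u ℕ.+ d ℕ.* i)
    middle-vanishes : ∀ i → i < suc m → + p ∣ℤ f (suc i)
    middle-vanishes i i<p = ∣m⇒∣m*n (w (u ℕ.+ d ℕ.* suc i)) (p∣[x-1]^p i (s≤s i<p))
    regroup : ∀ a b → -1ℤ * a + 0ℤ + 1ℤ * b ≡ b - a
    regroup = solve-∀

  Δ∘ⁿp^r≈Δ[p^r] : ∀ r (w : Seq) → (Δ ∘ⁿ (p ^ r)) w ≈ₛ Δ[ p ^ r ] w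
  Δ∘ⁿp^r≈Δ[p^r] zero    w u = ≈-refl
  Δ∘ⁿp^r≈Δ[p^r] (suc r) w u = begin
    (Δ ∘ⁿ (p ℕ.* p ^ r)) w u             ≡⟨ cong (λ F → F w u) (sym (∘ⁿ-* Δ p (p ^ r))) ⟩
    ((Δ ∘ⁿ (p ^ r)) ∘ⁿ p) w u
      ≈⟨ ∘ⁿ-≈ p p (Δ ∘ⁿ (p ^ r)) Δ[ p ^ r ] (Δ∘ⁿp^r≈Δ[p^r] r) (Δ-cong-≈ p (p ^ r)) w u ⟩
    (Δ[ p ^ r ] ∘ⁿ p) w u              ≈⟨ Δ∘ⁿp≈Δ[*p] (p ^ r) w u ⟩
    Δ[ p ^ r ℕ.* p ] w u               ≡⟨ cong (λ d → Δ[ d ] w u) (*-comm (p ^ r) p) ⟩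
    Δ[ p ℕ.* p ^ r ] w u               ∎
    where open ≈-Reasoning

  [x-1]^p≈x^p-1 : ∀ x → (x - 1ℤ) ℤ.^ p ≈ x ℤ.^ p - 1ℤ
  [x-1]^p≈x^p-1 x = begin
    (x - 1ℤ) ℤ.^ p                  ≡⟨ sym (ℤₚ.*-identityʳ _) ⟩
    (x - 1ℤ) ℤ.^ p * x ℤ.^ 0        ≡⟨ sym (Δ∘ⁿ-geometric p x 0) ⟩
    (Δ ∘ⁿ p) (x ℤ.^_) 0             ≈⟨ Δ∘ⁿp≈Δ[*p] 1 (x ℤ.^_) 0 ⟩
    x ℤ.^ (1 ℕ.* p) - x ℤ.^ 0       ≡⟨ cong (λ n → x ℤ.^ n - 1ℤ) (*-identityˡ p) ⟩
    x ℤ.^ p - 1ℤ                    ∎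
    where open ≈-Reasoning

  fermat-≈ : ∀ a → (+ a) ℤ.^ p ≈ + a
  fermat-≈ zero    = ≈-refl
  fermat-≈ (suc a) = begin
    (+ suc a) ℤ.^ p                        ≡⟨ cong (ℤ._^ p) +suc ⟩
    (+ a + 1ℤ) ℤ.^ p                       ≡⟨ sym (minus-plus ((+ a + 1ℤ) ℤ.^ p)) ⟩
    (+ a + 1ℤ) ℤ.^ p - 1ℤ + 1ℤ             ≈⟨ +-cong (≈-sym ([x-1]^p≈x^p-1 (+ a + 1ℤ))) ≈-refl ⟩
    (+ a + 1ℤ - 1ℤ) ℤ.^ p + 1ℤ             ≡⟨ cong (λ y → y ℤ.^ p + 1ℤ) (plus-minus (+ a)) ⟩
    (+ a) ℤ.^ p + 1ℤ                       ≈⟨ +-cong (fermat-≈ a) ≈-refl ⟩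
    + a + 1ℤ                               ≡⟨ sym +suc ⟩
    + suc a                                ∎
    where
    open ≈-Reasoning
    +suc : + suc a ≡ + a + 1ℤ
    +suc = ℤₚ.+-comm 1ℤ (+ a)
    minus-plus : ∀ y → y - 1ℤ + 1ℤ ≡ y
    minus-plus = solve-∀
    plus-minus : ∀ y → y + 1ℤ - 1ℤ ≡ y
    plus-minus = solve-∀

  pos-^ : ∀ a n → + (a ^ n) ≡ (+ a) ℤ.^ n
  pos-^ a zero    = refl
  pos-^ a (suc n) = trans (ℤₚ.pos-* a (a ^ n)) (cong (_*_ (+ a)) (pos-^ a n))

  fermat-∣ : ∀ a → + p ∣ℤ + a * ((+ a) ℤ.^ suc m - 1ℤ)
  fermat-∣ a = subst (+ p ∣ℤ_) (factor (+ a) _) (divides-difference (fermat-≈ a))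
    where
    factor : ∀ x y → x * y - x ≡ x * (y - 1ℤ)
    factor = solve-∀

  ∣x-1⇒x≡1+p* : ∀ x → x ≢ 0 → + p ∣ℤ + x - 1ℤ → ∃ λ q → x ≡ 1 ℕ.+ p ℕ.* q
  ∣x-1⇒x≡1+p* zero    x≢0 _   = contradiction refl x≢0
  ∣x-1⇒x≡1+p* (suc y) _   p∣y with ∣⇒∣ᵤ p∣y
  ... | divides q y≡q*p = q , cong suc (trans y≡q*p (*-comm q p))

  fermat : ∀ a → ¬ p ∣ a → ∃ λ q → a ^ suc m ≡ 1 ℕ.+ p ℕ.* q
  fermat a p∤a with euclidsLemma-ℤ p-prime (+ a) ((+ a) ℤ.^ suc m - 1ℤ) (fermat-∣ a)
  ... | inj₁ p∣a             = contradiction (∣⇒∣ᵤ p∣a) p∤a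
  ... | inj₂ p∣a^[p-1]-1     =
    ∣x-1⇒x≡1+p* (a ^ suc m) a^[p-1]≢0 (subst (λ z → + p ∣ℤ z - 1ℤ) (sym (pos-^ a (suc m))) p∣a^[p-1]-1)
    where
    a^[p-1]≢0 : a ^ suc m ≢ 0
    a^[p-1]≢0 a^[p-1]≡0 = p∤a (subst (p ∣_) (sym (m^n≡0⇒m≡0 a (suc m) a^[p-1]≡0)) (p ∣0))

module Totient (m : ℕ) (p-prime : Prime (suc (suc m))) where

  open import Data.Nat.Base using (zero; _+_; _*_; _^_; _≤_; z≤n; s≤s)
  open import Data.Nat.Properties using (_≟_; +-suc; +-comm; +-identityʳ; *-zeroʳ; *-comm; ≤-refl; <⇒≤)
  open import Data.Nat.Divisibility using (_∣_; m∣m*n; ∣m+n∣m⇒∣n)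
  open import Data.Nat.GCD using (gcd)
  open import Data.Nat.Coprimality using (coprime⇒gcd≡1; gcd≡1⇒coprime)
  open import Data.Nat.Tactic.RingSolver using (solve-∀)
  open import Data.List.Base using (filter; length; upTo; map; _++_; [_]; [])
  open import Data.List.Properties using (applyUpTo-∷ʳ; map-++; filter-++; length-++; filter-accept; filter-reject)
  open import Relation.Binary.PropositionalEquality hiding ([_])
  open import Relation.Nullary.Decidable using (Dec)
  open import Relation.Nullary.Negation using (¬_)

  open Primes

  p : ℕ
  p = suc (suc m)

  module Count (N : ℕ) where

    coprime? : ∀ k → Dec (gcd k N ≡ 1)
    coprime? k = gcd k N ≟ 1

    count : ℕ → ℕ
    count n = length (filter coprime? (map suc (upTo n)))

    count-suc : ∀ n → count (suc n) ≡ count n + length (filter coprime? [ suc n ])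
    count-suc n = begin
      length (filter coprime? (map suc (upTo (suc n))))
        ≡⟨ cong (λ ks → length (filter coprime? (map suc ks))) (sym (applyUpTo-∷ʳ (λ k → k) n)) ⟩
      length (filter coprime? (map suc (upTo n ++ [ n ])))
        ≡⟨ cong (λ ks → length (filter coprime? ks)) (map-++ suc (upTo n) [ n ]) ⟩
      length (filter coprime? (map suc (upTo n) ++ [ suc n ]))
        ≡⟨ cong length (filter-++ coprime? (map suc (upTo n)) [ suc n ]) ⟩
      length (filter coprime? (map suc (upTo n)) ++ filter coprime? [ suc n ])
        ≡⟨ length-++ (filter coprime? (map suc (upTo n))) ⟩
      count n + length (filter coprime? [ suc n ])
        ∎
      where open ≡-Reasoning

    count-suc-coprime : ∀ n → gcd (suc n) N ≡ 1 → count (suc n) ≡ suc (count n)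
    count-suc-coprime n coprime = trans (count-suc n)
      (trans (cong (λ ks → count n + length ks) (filter-accept coprime? {x = suc n} {xs = []} coprime))
             (+-comm (count n) 1))

    count-suc-¬coprime : ∀ n → ¬ gcd (suc n) N ≡ 1 → count (suc n) ≡ count n
    count-suc-¬coprime n ¬coprime = trans (count-suc n)
      (trans (cong (λ ks → count n + length ks) (filter-reject coprime? {x = suc n} {xs = []} ¬coprime))
             (+-identityʳ (count n)))

  φ[p^suc-r] : ∀ r → φ (p ^ suc r) ≡ p ^ r * suc m
  φ[p^suc-r] r = begin
    count (p * p ^ r)             ≡⟨ cong count (sym (+-identityʳ (p * p ^ r))) ⟩
    count (p * p ^ r + 0)         ≡⟨ count-blocks (p ^ r) 0 z≤n ⟩
    suc m * p ^ r + 0             ≡⟨ +-identityʳ _ ⟩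
    suc m * p ^ r                 ≡⟨ *-comm (suc m) (p ^ r) ⟩
    p ^ r * suc m                 ∎
    where
    open ≡-Reasoning
    open Count (p ^ suc r)
    -- Among 1, …, p j + i (with i < p) exactly the j multiples of p are not coprime to p ^ suc r.
    count-blocks : ∀ j i → i ≤ suc m → count (p * j + i) ≡ suc m * j + i
    count-blocks zero    zero    _    = trans (cong count (empty p)) (sym (empty (suc m)))
      where
      empty : ∀ n → n * 0 + 0 ≡ 0
      empty n = trans (+-identityʳ (n * 0)) (*-zeroʳ n)
    count-blocks (suc j) zero    _    = begin
      count (p * suc j + 0)       ≡⟨ cong count (trans (+-identityʳ (p * suc j)) (end-of-block m j)) ⟩
      count (suc (p * j + suc m)) ≡⟨ count-suc-¬coprime (p * j + suc m) not-coprime ⟩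
      count (p * j + suc m)       ≡⟨ count-blocks j (suc m) ≤-refl ⟩
      suc m * j + suc m           ≡⟨ regroup m j ⟩
      suc m * suc j + 0           ∎
      where
      end-of-block : ∀ m j → suc (suc m) * suc j ≡ suc (suc (suc m) * j + suc m)
      end-of-block = solve-∀
      regroup : ∀ m j → suc m * j + suc m ≡ suc m * suc j + 0
      regroup = solve-∀
      not-coprime : ¬ gcd (suc (p * j + suc m)) (p ^ suc r) ≡ 1
      not-coprime coprime = coprime⇒¬∣ p-prime (gcd≡1⇒coprime coprime) (m∣m*n (p ^ r))
                                       (subst (p ∣_) (end-of-block m j) (m∣m*n (suc j)))
    count-blocks j       (suc i) i<p = begin
      count (p * j + suc i)       ≡⟨ cong count (+-suc (p * j) i) ⟩
      count (suc (p * j + i))     ≡⟨ count-suc-coprime (p * j + i) (coprime⇒gcd≡1 (¬∣⇒coprime-^ p-prime (suc r) p∤))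
                                   ⟩
      suc (count (p * j + i))     ≡⟨ cong suc (count-blocks j i (<⇒≤ i<p)) ⟩
      suc (suc m * j + i)         ≡⟨ sym (+-suc (suc m * j) i) ⟩
      suc m * j + suc i           ∎
      where
      p∤ : ¬ p ∣ suc (p * j + i)
      p∤ p∣ = prime∤0<n<p p-prime (s≤s i<p)
                          (∣m+n∣m⇒∣n (subst (p ∣_) (sym (+-suc (p * j) i)) p∣) (m∣m*n j))

module EulerQuotient (m : ℕ) (p-prime : Prime (suc (suc m))) (p-odd : ¬ 2 ∣ suc (suc m)) where

  open import Data.Nat.Base using (zero; _+_; _*_; _∸_; _^_; pred; ≢-nonZero)
  open import Data.Nat.Properties
    using ( m^n≢0; ^-*-assoc; ^-distribˡ-+-*; *-comm; *-identityʳ; *-identityˡ; suc-injective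
          ; *-cancelˡ-≡; suc-pred; +-comm; _≟_)
  open import Data.Nat.DivMod using (_/_; _%_; m*n/n≡m; n/1≡n; 0/n≡0; %-congʳ; m%n%n≡m%n; [m+kn]%n≡m%n)
  open import Data.Nat.GCD using (gcd)
  open import Data.Nat.Coprimality using (coprime⇒gcd≡1; gcd≡1⇒coprime)
  open import Relation.Nullary.Decidable using (yes; no)
  open import Relation.Nullary.Negation using (contradiction)
  open import Data.Nat.Divisibility
    using (divides; ∣m+n∣m⇒∣n; m∣m*n; ∣-refl; ∣m⇒∣m*n; ∣m∣n⇒∣m+n; _∣?_; n∣m⇒m%n≡0)
  open import Data.Nat.Tactic.RingSolver using (solve-∀)
  open import Data.Product.Base using (∃; _,_; proj₁; proj₂)
  open import Relation.Binary.PropositionalEquality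

  open Arithmetic
  open Primes
  open Frobenius m p-prime p-odd using (p; fermat)
  open Totient m p-prime using (φ[p^suc-r])

  Q̃ : ℕ → ℕ → ℕ
  Q̃ r u = (u ^ φ (p ^ r) ∸ 1) / p ^ r
    where instance _ = m^n≢0 p r

  Q̃-unique : ∀ r u q → u ^ φ (p ^ r) ≡ 1 + p ^ r * q → Q̃ r u ≡ q
  Q̃-unique r u q u^φ≡ = begin
    (u ^ φ (p ^ r) ∸ 1) / p ^ r   ≡⟨ cong (λ x → (x ∸ 1) / p ^ r) u^φ≡ ⟩
    (p ^ r * q) / p ^ r           ≡⟨ cong (_/ p ^ r) (*-comm (p ^ r) q) ⟩
    (q * p ^ r) / p ^ r           ≡⟨ m*n/n≡m q (p ^ r) ⟩
    q                             ∎
    where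
    open ≡-Reasoning
    instance _ = m^n≢0 p r

  choose2[p]≡p*[p/2] : choose2 p ≡ p * (p / 2)
  choose2[p]≡p*[p/2] = begin
    choose2 p                          ≡⟨ cong choose2 p≡ ⟩
    choose2 (suc (p / 2 * 2))          ≡⟨ choose2-odd (p / 2) ⟩
    suc (p / 2 * 2) * (p / 2)          ≡⟨ cong (_* (p / 2)) (sym p≡) ⟩
    p * (p / 2)                        ∎
    where
    open ≡-Reasoning
    p≡ = odd⇒≡1+[/2]*2 p p-odd

  φ[p^suc-suc-r] : ∀ r → φ (p ^ suc (suc r)) ≡ φ (p ^ suc r) * p
  φ[p^suc-suc-r] r = begin
    φ (p ^ suc (suc r))       ≡⟨ φ[p^suc-r] (suc r) ⟩
    p * p ^ r * suc m         ≡⟨ rotate p (p ^ r) (suc m) ⟩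
    p ^ r * suc m * p         ≡⟨ cong (_* p) (sym (φ[p^suc-r] r)) ⟩
    φ (p ^ suc r) * p         ∎
    where
    open ≡-Reasoning
    rotate : ∀ a b c → a * b * c ≡ b * c * a
    rotate = solve-∀

  -- Raising to the p-th power multiplies the error term by p; the quadratic term does not
  -- spoil this because p divides choose2 p.
  euler-lift : ∀ r u q → u ^ φ (p ^ suc r) ≡ 1 + p ^ suc r * q →
               ∃ λ W → u ^ φ (p ^ suc (suc r)) ≡ 1 + p ^ suc (suc r) * (q + p ^ suc r * W)
  euler-lift r u q u^φ≡ =
    let Z , [1+y]^p≡ = [1+y]^n-expansion p (p ^ suc r * q) in
    p / 2 * q * q + p ^ r * q * q * q * Z , (begin
    u ^ φ (p ^ suc (suc r))
      ≡⟨ cong (u ^_) (φ[p^suc-suc-r] r) ⟩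
    u ^ (φ (p ^ suc r) * p)
      ≡⟨ sym (^-*-assoc u (φ (p ^ suc r)) p) ⟩
    (u ^ φ (p ^ suc r)) ^ p
      ≡⟨ cong (_^ p) u^φ≡ ⟩
    (1 + y) ^ p
      ≡⟨ [1+y]^p≡ ⟩
    1 + p * y + choose2 p * (y * y) + y * y * y * Z
      ≡⟨ cong (λ c → 1 + p * y + c * (y * y) + y * y * y * Z) choose2[p]≡p*[p/2] ⟩
    1 + p * y + p * (p / 2) * (y * y) + y * y * y * Z
      ≡⟨ regroup p (p ^ r) q (p / 2) Z ⟩
    1 + p ^ suc (suc r) * (q + p ^ suc r * (p / 2 * q * q + p ^ r * q * q * q * Z))
      ∎)
    where
    open ≡-Reasoning
    y = p ^ suc r * q
    regroup : ∀ p a q h Z →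
      1 + p * (p * a * q) + p * h * ((p * a * q) * (p * a * q)) + (p * a * q) * (p * a * q) * (p * a * q) * Z
        ≡ 1 + p * (p * a) * (q + p * a * (h * q * q + a * q * q * q * Z))
    regroup = solve-∀

  euler : ∀ r u → ¬ p ∣ u → ∃ λ q → u ^ φ (p ^ suc r) ≡ 1 + p ^ suc r * q
  euler zero    u p∤u =
    let q , u^[p-1]≡ = fermat u p∤u in
    q , (begin
    u ^ φ (p ^ 1)          ≡⟨ cong (u ^_) (trans (φ[p^suc-r] 0) (*-identityˡ (suc m))) ⟩
    u ^ suc m              ≡⟨ u^[p-1]≡ ⟩
    1 + p * q              ≡⟨ cong (λ x → 1 + x * q) (sym (*-identityʳ p)) ⟩
    1 + p ^ 1 * q          ∎)
    where open ≡-Reasoning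
  euler (suc r) u p∤u =
    let q , u^φ≡ = euler r u p∤u
        W , u^φ′≡ = euler-lift r u q u^φ≡
    in q + p ^ suc r * W , u^φ′≡

  euler-Q̃ : ∀ r u → ¬ p ∣ u → u ^ φ (p ^ suc r) ≡ 1 + p ^ suc r * Q̃ (suc r) u
  euler-Q̃ r u p∤u =
    let q , u^φ≡ = euler r u p∤u in
    trans u^φ≡ (cong (λ x → 1 + p ^ suc r * x) (sym (Q̃-unique (suc r) u q u^φ≡)))

  Q̃-suc : ∀ r u → ¬ p ∣ u → ∃ λ W → Q̃ (suc (suc r)) u ≡ Q̃ (suc r) u + p ^ suc r * W
  Q̃-suc r u p∤u =
    let W , u^φ≡ = euler-lift r u (Q̃ (suc r) u) (euler-Q̃ r u p∤u) in
    W , Q̃-unique (suc (suc r)) u _ u^φ≡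

  ¬∣-shift : ∀ k u → ¬ p ∣ u → ¬ p ∣ u + p ^ suc k
  ¬∣-shift k u p∤u p∣u+R = p∤u (∣m+n∣m⇒∣n (subst (p ∣_) (+-comm u (p ^ suc k)) p∣u+R) (m∣m*n (p ^ k)))

  -- Expand (u + R) ^ φ R to first order in R = p ^ suc k, then use φ R = p ^ k (p − 1),
  -- p − 1 ≡ −1 and, by Fermat, u ^ (φ R − 1) ≡ u ^ (p − 2) modulo p.
  Q̃-shift : ∀ k u → ¬ p ∣ u →
            ∃ λ V → Q̃ (suc k) (u + p ^ suc k) + p ^ k * u ^ m ≡ Q̃ (suc k) u + p ^ suc k * V
  Q̃-shift k u p∤u = U + suc m * U * qF * T + Z , (begin
    q′ + p ^ k * U
      ≡⟨ cong₂ _+_ q′≡ (cong (_* U) p^k≡) ⟩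
    q + suc n * u ^ n + R * Z + suc e * U
      ≡⟨ cong₂ (λ x y → q + suc n * x + y * Z + suc e * U) u^n≡ R≡ ⟩
    q + suc n * (U * (1 + p * qF * T)) + p * suc e * Z + suc e * U
      ≡⟨ regroup m e q U qF T Z ⟩
    q + p * suc e * (U + suc m * U * qF * T + Z)
      ≡⟨ cong (λ x → q + x * (U + suc m * U * qF * T + Z)) (sym R≡) ⟩
    q + R * (U + suc m * U * qF * T + Z)
      ∎)
    where
    open ≡-Reasoning
    R = p ^ suc k
    e = pred (p ^ k)
    p^k≡ : p ^ k ≡ suc e
    p^k≡ = sym (suc-pred (p ^ k) {{m^n≢0 p k}})
    R≡ : R ≡ p * suc e
    R≡ = cong (p *_) p^k≡
    n = m + e * suc m
    φ[R]≡ : φ R ≡ suc n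
    φ[R]≡ = trans (φ[p^suc-r] k) (cong (_* suc m) p^k≡)
    q = Q̃ (suc k) u
    q′ = Q̃ (suc k) (u + R)
    U = u ^ m
    qF = proj₁ (fermat u p∤u)
    T = proj₁ ([1+y]^n≡1+y* e (p * qF))
    Z = proj₁ ([x+y]^suc-n-expansion n u R)
    Rq′≡ : R * q′ ≡ R * (q + suc n * u ^ n + R * Z)
    Rq′≡ = suc-injective (begin
      1 + R * q′
        ≡⟨ sym (trans (cong ((u + R) ^_) (sym φ[R]≡)) (euler-Q̃ k (u + R) (¬∣-shift k u p∤u))) ⟩
      (u + R) ^ suc n                               ≡⟨ proj₂ ([x+y]^suc-n-expansion n u R) ⟩
      u ^ suc n + suc n * u ^ n * R + R * R * Z     ≡⟨ cong (λ x → x + suc n * u ^ n * R + R * R * Z)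
                                                            (trans (cong (u ^_) (sym φ[R]≡)) (euler-Q̃ k u p∤u)) ⟩
      1 + R * q + suc n * u ^ n * R + R * R * Z     ≡⟨ factor R q (suc n * u ^ n) Z ⟩
      1 + R * (q + suc n * u ^ n + R * Z)           ∎)
      where
      factor : ∀ R q a Z → 1 + R * q + a * R + R * R * Z ≡ 1 + R * (q + a + R * Z)
      factor = solve-∀
    q′≡ : q′ ≡ q + suc n * u ^ n + R * Z
    q′≡ = *-cancelˡ-≡ q′ _ R {{m^n≢0 p (suc k)}} Rq′≡
    u^n≡ : u ^ n ≡ U * (1 + p * qF * T)
    u^n≡ = begin
      u ^ (m + e * suc m)          ≡⟨ ^-distribˡ-+-* u m (e * suc m) ⟩
      U * u ^ (e * suc m)          ≡⟨ cong (λ x → U * u ^ x) (*-comm e (suc m)) ⟩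
      U * u ^ (suc m * e)          ≡⟨ cong (U *_) (sym (^-*-assoc u (suc m) e)) ⟩
      U * (u ^ suc m) ^ e          ≡⟨ cong (λ x → U * x ^ e) (proj₂ (fermat u p∤u)) ⟩
      U * (1 + p * qF) ^ e         ≡⟨ cong (U *_) (proj₂ ([1+y]^n≡1+y* e (p * qF))) ⟩
      U * (1 + p * qF * T)         ∎
    regroup : ∀ m e q U qF T Z →
      q + suc (m + e * suc m) * (U * (1 + suc (suc m) * qF * T)) + suc (suc m) * suc e * Z + suc e * U
        ≡ q + suc (suc m) * suc e * (U + suc m * U * qF * T + Z)
    regroup = solve-∀

  Q≡Q̃%p^r : ∀ r u → ¬ p ∣ u → Q p r u ≡ (Q̃ r u % p ^ r) {{m^n≢0 p r}}
  Q≡Q̃%p^r r u p∤u with gcd u p ≟ 1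
  ... | yes _        = refl
  ... | no ¬coprime = contradiction (coprime⇒gcd≡1 (¬∣⇒coprime p-prime p∤u)) ¬coprime

  Q≡0 : ∀ r u → p ∣ u → Q p r u ≡ 0
  Q≡0 r u p∣u with gcd u p ≟ 1
  ... | yes coprime = contradiction p∣u (coprime⇒¬∣ p-prime (gcd≡1⇒coprime coprime) ∣-refl)
  ... | no _        = refl

  H≡Q̃/p^k%p : ∀ k u → ¬ p ∣ u → H p k u ≡ (Q̃ (suc k) u / p ^ k) {{m^n≢0 p k}} % p
  H≡Q̃/p^k%p zero    u p∤u = begin
    Q p 1 u                      ≡⟨ Q≡Q̃%p^r 1 u p∤u ⟩
    Q̃ 1 u % (p * 1)              ≡⟨ %-congʳ {o = Q̃ 1 u} (*-identityʳ p) ⟩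
    Q̃ 1 u % p                    ≡⟨ cong (_% p) (sym (n/1≡n (Q̃ 1 u))) ⟩
    Q̃ 1 u / 1 % p                ∎
    where open ≡-Reasoning
  H≡Q̃/p^k%p (suc k) u p∤u = begin
    ((Q p (suc (suc k)) u ∸ Q p (suc k) u) / M) % p
      ≡⟨ cong₂ (λ x y → ((x ∸ y) / M) % p) (Q≡Q̃%p^r (suc (suc k)) u p∤u) (Q≡Q̃%p^r (suc k) u p∤u) ⟩
    ((Q̃₂ % (p * M) ∸ Q̃₁ % M) / M) % p
      ≡⟨ cong (λ x → ((Q̃₂ % (p * M) ∸ x) / M) % p) Q̃₁%M≡Q̃₂%M ⟩
    ((Q̃₂ % (p * M) ∸ Q̃₂ % M) / M) % p
      ≡⟨ cong (_% p) ([x%ab∸x%b]/b≡x/b%a Q̃₂ p M) ⟩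
    Q̃₂ / M % p % p
      ≡⟨ m%n%n≡m%n (Q̃₂ / M) p ⟩
    Q̃₂ / M % p
      ∎
    where
    open ≡-Reasoning
    M = p ^ suc k
    instance
      _ = m^n≢0 p (suc k)
      _ = m^n≢0 p (suc (suc k))
    Q̃₁ = Q̃ (suc k) u
    Q̃₂ = Q̃ (suc (suc k)) u
    Q̃₁%M≡Q̃₂%M : Q̃₁ % M ≡ Q̃₂ % M
    Q̃₁%M≡Q̃₂%M =
      let W , Q̃₂≡ = Q̃-suc k u p∤u in
      sym (trans (cong (_% M) (trans Q̃₂≡ (cong (Q̃₁ +_) (*-comm M W)))) ([m+kn]%n≡m%n Q̃₁ W M))

  H≡0 : ∀ k u → p ∣ u → H p k u ≡ 0
  H≡0 zero    u p∣u = Q≡0 1 u p∣u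
  H≡0 (suc k) u p∣u =
    trans (cong₂ (λ x y → ((x ∸ y) / p ^ suc k) % p) (Q≡0 (suc (suc k)) u p∣u) (Q≡0 (suc k) u p∣u))
          (cong (_% p) (0/n≡0 (p ^ suc k)))
    where instance _ = m^n≢0 p (suc k)

  p∣u⇒p∣u^[p-2] : ∀ u → p ∣ u → p ∣ u ^ m
  p∣u⇒p∣u^[p-2] u p∣u =
    subst (λ n → p ∣ u ^ n) (suc-pred m {{≢-nonZero m≢0}}) (∣m⇒∣m*n (u ^ pred m) p∣u)
    where
    m≢0 : m ≢ 0
    m≢0 m≡0 = p-odd (subst (λ n → 2 ∣ suc (suc n)) (sym m≡0) ∣-refl)

  H-shift-∣ : ∀ k u → p ∣ u → (H p k (u + p ^ suc k) + u ^ m) % p ≡ H p k u % p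
  H-shift-∣ k u p∣u = begin
    (H p k (u + p ^ suc k) + u ^ m) % p  ≡⟨ cong (λ h → (h + u ^ m) % p) (H≡0 k (u + p ^ suc k) p∣u+p^suc-k) ⟩
    u ^ m % p                            ≡⟨ n∣m⇒m%n≡0 (u ^ m) p (p∣u⇒p∣u^[p-2] u p∣u) ⟩
    0                                    ≡⟨ cong (_% p) (sym (H≡0 k u p∣u)) ⟩
    H p k u % p                          ∎
    where
    open ≡-Reasoning
    p∣u+p^suc-k = ∣m∣n⇒∣m+n p∣u (m∣m*n (p ^ k))

  H-shift-∤ : ∀ k u → ¬ p ∣ u → (H p k (u + p ^ suc k) + u ^ m) % p ≡ H p k u % p
  H-shift-∤ k u p∤u = begin
    (H p k (u + R) + U) % p          ≡⟨ cong (λ h → (h + U) % p) (H≡Q̃/p^k%p k (u + R) (¬∣-shift k u p∤u)) ⟩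
    (A / M % p + U) % p              ≡⟨ [m%n+k]%n≡[m+k]%n (A / M) U p ⟩
    (A / M + U) % p                  ≡⟨ cong (_% p) (sym ([m+kn]/n≡m/n+k A U M)) ⟩
    (A + U * M) / M % p              ≡⟨ cong (λ x → x / M % p) shift ⟩
    (B + p * V * M) / M % p          ≡⟨ cong (_% p) ([m+kn]/n≡m/n+k B (p * V) M) ⟩
    (B / M + p * V) % p              ≡⟨ cong (λ x → (B / M + x) % p) (*-comm p V) ⟩
    (B / M + V * p) % p              ≡⟨ [m+kn]%n≡m%n (B / M) V p ⟩
    B / M % p                        ≡⟨ sym (m%n%n≡m%n (B / M) p) ⟩
    B / M % p % p                    ≡⟨ cong (_% p) (sym (H≡Q̃/p^k%p k u p∤u)) ⟩
    H p k u % p                      ∎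
    where
    open ≡-Reasoning
    instance _ = m^n≢0 p k
    R = p ^ suc k
    M = p ^ k
    U = u ^ m
    A = Q̃ (suc k) (u + R)
    B = Q̃ (suc k) u
    V = proj₁ (Q̃-shift k u p∤u)
    shift : A + U * M ≡ B + p * V * M
    shift = begin
      A + U * M           ≡⟨ cong (A +_) (*-comm U M) ⟩
      A + M * U           ≡⟨ proj₂ (Q̃-shift k u p∤u) ⟩
      B + p * M * V       ≡⟨ cong (B +_) (rotate p M V) ⟩
      B + p * V * M       ∎
      where
      rotate : ∀ a b c → a * b * c ≡ a * c * b
      rotate = solve-∀

  H-shift : ∀ k u → (H p k (u + p ^ suc k) + u ^ m) % p ≡ H p k u % p
  H-shift k u with p ∣? u
  ... | yes p∣u = H-shift-∣ k u p∣u
  ... | no  p∤u = H-shift-∤ k u p∤u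

module DigitSequence (m : ℕ) (p-prime : Prime (suc (suc m))) (p-odd : ¬ 2 ∣ suc (suc m)) (k : ℕ) where

  open import Data.Nat.Base as ℕ using (zero; _+_; _∸_; _^_; _<_; _!)
  open import Function.Base using (_∘_)
  open import Data.Nat.Properties using (m∸n+n≡m; ≤-pred; *-identityˡ; n<1+n; <-trans)
  open import Data.Nat.DivMod using (_%_)
  open import Data.Integer.Base as ℤ using (ℤ; +_; -_; _-_; 0ℤ; -1ℤ; ∣_∣)
  open import Data.Integer.Properties using (pos-+; ∣-i∣≡∣i∣; abs-*)
  import Data.Integer.Properties as ℤₚ
  open import Data.Integer.DivMod using (_%ℕ_)
  open import Data.Integer.Divisibility.Signed using (∣⇒∣ᵤ)
  open import Data.Integer.Tactic.RingSolver using (solve-∀)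
  open import Data.Fin.Base using (Fin; toℕ) renaming (zero to fzero; suc to fsuc)
  open import Data.Product.Base using (_,_)
  open import Relation.Binary.PropositionalEquality

  open Sums
  open Differences
  open Polynomials
  open Primes

  open Frobenius m p-prime p-odd
  open EulerQuotient m p-prime p-odd
  open Congruence p
  open Recurrences p-prime

  s : Seq
  s u = + H p k u

  R : ℕ
  R = p ^ suc k

  L : ℕ
  L = suc (m + R)

  -u^[p-2] : Seq
  -u^[p-2] u = - (+ u) ℤ.^ m

  Δ[R]s≈-u^[p-2] : Δ[ R ] s ≈ₛ -u^[p-2]
  Δ[R]s≈-u^[p-2] u = begin
    + H p k (u + R) - + H p k u                ≡⟨ cancel (+ H p k (u + R)) (+ H p k u) (+ (u ^ m)) ⟩
    + H p k (u + R) ℤ.+ + (u ^ m) - + H p k u - + (u ^ m)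
      ≈⟨ -‿cong₂ (-‿cong₂ (≈-trans (≈-reflexive (sym (pos-+ (H p k (u + R)) (u ^ m))))
                                     (%≡%⇒≈ _ _ (H-shift k u)))
                           (≈-refl {+ H p k u}))
                 (≈-refl {+ (u ^ m)}) ⟩
    + H p k u - + H p k u - + (u ^ m)          ≡⟨ cancel′ (+ H p k u) (+ (u ^ m)) ⟩
    - + (u ^ m)                                ≡⟨ cong -_ (pos-^ u m) ⟩
    - (+ u) ℤ.^ m                              ∎
    where
    open ≈-Reasoning
    cancel : ∀ a b c → a - b ≡ a ℤ.+ c - b - c
    cancel = solve-∀
    cancel′ : ∀ b c → b - b - c ≡ - c
    cancel′ = solve-∀

  Δ∘ⁿ[j+R]s≈Δ∘ⁿj[-u^[p-2]] : ∀ j → (Δ ∘ⁿ (j + R)) s ≈ₛ (Δ ∘ⁿ j) -u^[p-2]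
  Δ∘ⁿ[j+R]s≈Δ∘ⁿj[-u^[p-2]] j u = begin
    (Δ ∘ⁿ (j + R)) s u              ≡⟨ cong (λ F → F s u) (∘ⁿ-homo Δ j R) ⟩
    (Δ ∘ⁿ j) ((Δ ∘ⁿ R) s) u         ≈⟨ ∘ⁿ-cong-≈ p j Δ (Δ-cong-≈ p 1) Δ∘ⁿR-s≈-u^[p-2] u ⟩
    (Δ ∘ⁿ j) -u^[p-2] u             ∎
    where
    open ≈-Reasoning
    Δ∘ⁿR-s≈-u^[p-2] : (Δ ∘ⁿ R) s ≈ₛ -u^[p-2]
    Δ∘ⁿR-s≈-u^[p-2] v = ≈-trans (Δ∘ⁿp^r≈Δ[p^r] (suc k) s v) (Δ[R]s≈-u^[p-2] v)

  -u^[p-2]-leading : LeadingTerm m -1ℤ -u^[p-2]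
  -u^[p-2]-leading = Deg<-cong m (Deg<-zero m) (λ u → sym (vanish ((+ u) ℤ.^ m)))
    where
    vanish : ∀ x → - x - -1ℤ ℤ.* x ≡ 0ℤ
    vanish = solve-∀

  Δ∘ⁿL-s-vanishes : Vanishes ((Δ ∘ⁿ L) s)
  Δ∘ⁿL-s-vanishes u = begin
    (Δ ∘ⁿ (suc m + R)) s u          ≈⟨ Δ∘ⁿ[j+R]s≈Δ∘ⁿj[-u^[p-2]] (suc m) u ⟩
    (Δ ∘ⁿ suc m) -u^[p-2] u         ≡⟨ Δ∘ⁿ-beyond-degree m -1ℤ -u^[p-2] -u^[p-2]-leading u ⟩
    0ℤ                              ∎
    where open ≈-Reasoning

  Δ∘ⁿ[L-1]s[0]≉0 : ¬ (Δ ∘ⁿ (m + R)) s 0 ≈ 0ℤ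
  Δ∘ⁿ[L-1]s[0]≉0 Δ∘ⁿs[0]≈0 =
    prime∤! p-prime m (<-trans (n<1+n m) (n<1+n (suc m))) (subst (p ∣_) ∣-m!∣≡m! (∣⇒∣ᵤ (≈0⇒∣ -m!≈0)))
    where
    -m!≈0 : -1ℤ ℤ.* + (m !) ≈ 0ℤ
    -m!≈0 = begin
      -1ℤ ℤ.* + (m !)                 ≡⟨ sym (Δ∘ⁿ-leading m -1ℤ -u^[p-2] -u^[p-2]-leading 0) ⟩
      (Δ ∘ⁿ m) -u^[p-2] 0             ≈⟨ ≈-sym (Δ∘ⁿ[j+R]s≈Δ∘ⁿj[-u^[p-2]] m 0) ⟩
      (Δ ∘ⁿ (m + R)) s 0              ≈⟨ Δ∘ⁿs[0]≈0 ⟩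
      0ℤ                              ∎
      where open ≈-Reasoning
    ∣-m!∣≡m! : ∣ -1ℤ ℤ.* + (m !) ∣ ≡ m !
    ∣-m!∣≡m! = trans (abs-* -1ℤ (+ (m !))) (*-identityˡ (m !))

  -- The coefficients of the recurrence with characteristic polynomial (x − 1)ᴸ, as residues mod p.
  coeff : ℕ → ℕ
  coeff j = (- [x-1]^ L j) %ℕ p

  s-recurrence : Recurrence L (λ j → + coeff j) s
  s-recurrence u = begin
    s (u + L)                                         ≡⟨ sym (cancel (Σ< L h) (s (u + L))) ⟩
    Σ< L h ℤ.+ s (u + L) - Σ< L h                     ≡⟨ cong (_- Σ< L h) (sym expansion) ⟩
    (Δ ∘ⁿ L) s u - Σ< L h                             ≈⟨ -‿cong₂ (Δ∘ⁿL-s-vanishes u) (≈-refl {Σ< L h}) ⟩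
    0ℤ - Σ< L h                                       ≡⟨ ℤₚ.+-identityˡ (- Σ< L h) ⟩
    - Σ< L h                                          ≡⟨ sym (Σ<-neg L h) ⟩
    Σ< L (λ j → - ([x-1]^ L j ℤ.* s (u + 1 ℕ.* j)))   ≡⟨ Σ<-cong L (λ j _ → negate j) ⟩
    Σ< L (λ j → - [x-1]^ L j ℤ.* s (u + j))           ≈⟨ Σ<-cong-≈ L (λ j _ → *-congʳ (s (u + j)) (reduce j)) ⟩
    Σ< L (λ j → + coeff j ℤ.* s (u + j))              ∎
    where
    open ≈-Reasoning
    negate : ∀ j → - ([x-1]^ L j ℤ.* s (u + 1 ℕ.* j)) ≡ - [x-1]^ L j ℤ.* s (u + j)
    negate j = trans (ℤₚ.neg-distribˡ-* ([x-1]^ L j) (s (u + 1 ℕ.* j)))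
                     (cong (λ i → - [x-1]^ L j ℤ.* s (u + i)) (*-identityˡ j))
    reduce : ∀ j → - [x-1]^ L j ≈ + coeff j
    reduce j = ≈-sym (+[%ℕ]≈ (- [x-1]^ L j))
    h : ℕ → ℤ
    h i = [x-1]^ L i ℤ.* s (u + 1 ℕ.* i)
    expansion : (Δ ∘ⁿ L) s u ≡ Σ< L h ℤ.+ s (u + L)
    expansion = trans (Δ∘ⁿ-expansion 1 L s u)
      (cong (ℤ._+_ (Σ< L h))
            (trans (cong₂ (λ a i → a ℤ.* s (u + i)) ([x-1]^-leading L) (*-identityˡ L)) (ℤₚ.*-identityˡ _)))
    cancel : ∀ a b → a ℤ.+ b - a ≡ b
    cancel = solve-∀

  has-recurrence : HasRecurrence p (H p k) L
  has-recurrence = coeff ∘ toℕ , coeff₀≢0 , recurrence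
    where
    coeff₀≢0 : ¬ coeff 0 % p ≡ 0 % p
    coeff₀≢0 coeff₀≡0 = prime∤1 p-prime (subst (p ∣_) ∣-[x-1]^L₀∣≡1 (∣⇒∣ᵤ (≈0⇒∣ -[x-1]^L₀≈0)))
      where
      -[x-1]^L₀≈0 : - [x-1]^ L 0 ≈ 0ℤ
      -[x-1]^L₀≈0 = ≈-trans (≈-sym (+[%ℕ]≈ (- [x-1]^ L 0))) (%≡%⇒≈ (coeff 0) 0 coeff₀≡0)
      ∣-[x-1]^L₀∣≡1 : ∣ - [x-1]^ L 0 ∣ ≡ 1
      ∣-[x-1]^L₀∣≡1 = trans (∣-i∣≡∣i∣ ([x-1]^ L 0)) (∣[x-1]^-constant∣ L)
    recurrence : ∀ u → H p k (u + L) ≡[ p ] sumFin L (λ i → coeff (toℕ i) ℕ.* H p k (u + toℕ i))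
    recurrence u = ≈⇒%≡% _ _ (≈-trans (s-recurrence u) (≈-reflexive (sym (begin
      + sumFin L (λ i → coeff (toℕ i) ℕ.* H p k (u + toℕ i))
        ≡⟨ +sumFin≡Σ< L (coeff ∘ toℕ) (λ j → H p k (u + j)) ⟩
      Σ< L (λ j → + extendByZero {L} (coeff ∘ toℕ) j ℤ.* s (u + j))
        ≡⟨ Σ<-cong L (λ j j<L → cong (λ c → + c ℤ.* s (u + j)) (extendByZero-toℕ L coeff j j<L)) ⟩
      Σ< L (λ j → + coeff j ℤ.* s (u + j))  ∎))))
      where open ≡-Reasoning

  no-shorter-recurrence : ∀ L′ → L′ < L → ¬ HasRecurrence p (H p k) L′
  no-shorter-recurrence zero    _   ()
  no-shorter-recurrence (suc l) l<L (c , _ , recurrence) = Δ∘ⁿ[L-1]s[0]≉0 (Δ∘ⁿ[L-1]s-vanishes 0)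
    where
    s-recurrence′ : Recurrence (suc l) (λ j → + extendByZero c j) s
    s-recurrence′ u =
      ≈-trans (%≡%⇒≈ _ _ (recurrence u)) (≈-reflexive (+sumFin≡Σ< (suc l) c (λ j → H p k (u + j))))
    Δ∘ⁿ[suc-l]s-vanishes : Vanishes ((Δ ∘ⁿ suc l) s)
    Δ∘ⁿ[suc-l]s-vanishes =
      Δ∘ⁿ-vanishes-at-recurrence-length (suc l) (λ j → + extendByZero c j) {s} s-recurrence′
                                        L Δ∘ⁿL-s-vanishes
    Δ∘ⁿ[L-1]s-vanishes : Vanishes ((Δ ∘ⁿ (m + R)) s)
    Δ∘ⁿ[L-1]s-vanishes = subst Vanishes
      (trans (cong (λ F → F s) (sym (∘ⁿ-homo Δ (m + R ∸ suc l) (suc l))))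
             (cong (λ n → (Δ ∘ⁿ n) s) (m∸n+n≡m (≤-pred l<L))))
      (Δ∘ⁿ-vanishes (m + R ∸ suc l) Δ∘ⁿ[suc-l]s-vanishes)

  linear-complexity : LinearComplexity p (H p k) L
  linear-complexity = has-recurrence , no-shorter-recurrence

open import Data.Nat.Base using (_+_; _∸_; _^_; NonZero; nonTrivial⇒n>1; s≤s)
open import Data.Nat.Primality using (prime⇒nonTrivial)
open import Data.Nat.Properties using (+-suc; +-comm)
open import Relation.Binary.PropositionalEquality using (_≡_; subst; sym; trans; cong)
open import Relation.Nullary.Negation using (contradiction)

p^[k+1]+p∸1≡1+[p-2]+p^[k+1] : ∀ m k →
  suc (suc m) ^ suc k + suc (suc m) ∸ 1 ≡ suc (m + suc (suc m) ^ suc k)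
p^[k+1]+p∸1≡1+[p-2]+p^[k+1] m k =
  trans (cong (_∸ 1) (+-suc R (suc m))) (trans (+-suc R m) (cong suc (+-comm R m)))
  where R = suc (suc m) ^ suc k

theorem3 : (p : ℕ) → .{{_ : NonZero p}} → Prime p → ¬ (2 ∣ p) →
    (k : ℕ) → LinearComplexity p (H p k) (p ^ suc k + p ∸ 1)
theorem3 p@0 p-prime _ _ = contradiction (nonTrivial⇒n>1 p {{prime⇒nonTrivial p-prime}}) λ ()
theorem3 p@1 p-prime _ _ = contradiction (nonTrivial⇒n>1 p {{prime⇒nonTrivial p-prime}}) λ { (s≤s ()) }
theorem3 p@(suc (suc m)) p-prime p-odd k =
  subst (LinearComplexity p (H p k)) (sym (p^[k+1]+p∸1≡1+[p-2]+p^[k+1] m k))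
        (DigitSequence.linear-complexity m p-prime p-odd k)
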